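{- For each $*\in\{\mathsf{ID},\mathsf{MP},\mathsf{MPID}\}$ and every sequent $\Gamma\Rightarrow\Delta$ over $\mathcal{L}$ with $|\Delta|\le1$: $\Gamma\Rightarrow\Delta$ is derivable in $\mathsf{S.ConstCK}*$ if and only if $\iota(\Gamma\Rightarrow\Delta)$ is derivable in $\mathsf{ConstCK}*$.
   Context: $\mathcal{L}$: formulas $\varphi ::= p \mid \bot \mid \varphi\wedge\varphi \mid \varphi\vee\varphi \mid \varphi\to\varphi \mid \varphi \mathbin{\Box\!\!\rightarrow} \varphi \mid \varphi \mathbin{\Diamond\!\!\rightarrow}\varphi$; $\wedge,\vee$ bind more strongly than $\to,\mathbin{\Box\!\!\rightarrow},\mathbin{\Diamond\!\!\rightarrow}$; $\neg\varphi:=\varphi\to\bot$, $\top:=\neg\bot$, $\varphi\leftrightarrow\psi:=(\varphi\to\psi)\wedge(\psi\to\varphi)$. $\mathsf{ConstCK}$: intuitionistic propositional logic in $\mathcal{L}$ with modus ponens, plus CM$_\Box$: $(\varphi\mathbin{\Box\!\!\rightarrow}\psi\wedge\chi)\to(\varphi\mathbin{\Box\!\!\rightarrow}\psi)\wedge(\varphi\mathbin{\Box\!\!\rightarrow}\chi)$; CC$_\Box$: $(\varphi\mathbin{\Box\!\!\rightarrow}\psi)\wedge(\varphi\mathbin{\Box\!\!\rightarrow}\chi)\to(\varphi\mathbin{\Box\!\!\rightarrow}\psi\wedge\chi)$; CN$_\Box$: $\varphi\mathbin{\Box\!\!\rightarrow}\top$; CN$_\Diamond$: $\neg(\varphi\mathbin{\Diamond\!\!\rightarrow}\bot)$;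 CK$_\Diamond$: $(\varphi\mathbin{\Box\!\!\rightarrow}(\psi\to\chi))\to((\varphi\mathbin{\Diamond\!\!\rightarrow}\psi)\to(\varphi\mathbin{\Diamond\!\!\rightarrow}\chi))$; rules RA$_\Box$: from $\varphi\leftrightarrow\rho$ infer $(\varphi\mathbin{\Box\!\!\rightarrow}\psi)\leftrightarrow(\rho\mathbin{\Box\!\!\rightarrow}\psi)$; RC$_\Box$: from $\psi\leftrightarrow\chi$ infer $(\varphi\mathbin{\Box\!\!\rightarrow}\psi)\leftrightarrow(\varphi\mathbin{\Box\!\!\rightarrow}\chi)$; RA$_\Diamond$, RC$_\Diamond$ likewise with $\mathbin{\Diamond\!\!\rightarrow}$. Further axioms: ID$_\Box$: $\varphi\mathbin{\Box\!\!\rightarrow}\varphi$; MP$_\Box$: $(\varphi\mathbin{\Box\!\!\rightarrow}\psi)\to(\varphi\to\psi)$; MP$_\Diamond$: $\varphi\wedge\psi\to(\varphi\mathbin{\Diamond\!\!\rightarrow}\psi)$. $\mathsf{ConstCKID}=\mathsf{ConstCK}+$ID$_\Box$; $\mathsf{ConstCKMP}=\mathsf{ConstCK}+$MP$_\Box$, MP$_\Diamond$; $\mathsf{ConstCKMPID}=\mathsf{ConstCK}+$MP$_\Box$, MP$_\Diamond$, ID$_\Box$. Sequents: finite multisets, $|\Delta|\le1$; $\iota(\Gamma\Rightarrow\Delta)=\bigwedge\Gamma\to\bigvee\Delta$ if $\Gamma\ne\emptyset$, $\bigvee\Delta$ otherwise, $\bigvee\emptyset=\bot$. $\varphi\Leftrightarrow\rho$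 abbreviates the sequents $\varphi\Rightarrow\rho$, $\rho\Rightarrow\varphi$. $n\ge0$. Propositional rules: init: $\Gamma,p\Rightarrow p$; $\bot_L$: $\Gamma,\bot\Rightarrow\Delta$; $\wedge_L$: $\Gamma,\varphi,\psi\Rightarrow\Delta$ / $\Gamma,\varphi\wedge\psi\Rightarrow\Delta$; $\wedge_R$: $\Gamma\Rightarrow\varphi$, $\Gamma\Rightarrow\psi$ / $\Gamma\Rightarrow\varphi\wedge\psi$; $\vee_L$: $\Gamma,\varphi\Rightarrow\Delta$, $\Gamma,\psi\Rightarrow\Delta$ / $\Gamma,\varphi\vee\psi\Rightarrow\Delta$; $\vee_R^{1}$: $\Gamma\Rightarrow\varphi$ / $\Gamma\Rightarrow\varphi\vee\psi$; $\vee_R^{2}$: $\Gamma\Rightarrow\psi$ / $\Gamma\Rightarrow\varphi\vee\psi$; $\to_R$: $\Gamma,\varphi\Rightarrow\psi$ / $\Gamma\Rightarrow\varphi\to\psi$; $\to_L$: $\Gamma,\varphi\to\psi\Rightarrow\varphi$, $\Gamma,\psi\Rightarrow\Delta$ / $\Gamma,\varphi\to\psi\Rightarrow\Delta$. With $P=\rho_1\mathbin{\Box\!\!\rightarrow}\sigma_1,\dots,\rho_n\mathbin{\Box\!\!\rightarrow}\sigma_n$: $\Box$: $\{\varphi\Leftrightarrow\rho_i\}_{i\le n}$, $\sigma_1,\dots,\sigma_n\Rightarrow\psi$ / $\Gamma,P\Rightarrow\varphi\mathbin{\Box\!\!\rightarrow}\psi$; $\Diamond$: $\{\varphi\Leftrightarrow\rho_i\}_{i\le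 n}$, $\varphi\Leftrightarrow\eta$, $\sigma_1,\dots,\sigma_n,\psi\Rightarrow\vartheta$ / $\Gamma,P,\varphi\mathbin{\Diamond\!\!\rightarrow}\psi\Rightarrow\eta\mathbin{\Diamond\!\!\rightarrow}\vartheta$; $\Box\Diamond$: $\{\varphi\Leftrightarrow\rho_i\}_{i\le n}$, $\sigma_1,\dots,\sigma_n,\psi\Rightarrow$ / $\Gamma,P,\varphi\mathbin{\Diamond\!\!\rightarrow}\psi\Rightarrow\Delta$; $\Box^{id}$, $\Diamond^{id}$, $\Box\Diamond^{id}$: as $\Box$, $\Diamond$, $\Box\Diamond$ but with $\varphi$ added to the antecedent of the last premiss ($\sigma_1,\dots,\sigma_n,\varphi\Rightarrow\psi$; $\sigma_1,\dots,\sigma_n,\varphi,\psi\Rightarrow\vartheta$; $\sigma_1,\dots,\sigma_n,\varphi,\psi\Rightarrow$ respectively); $mp_\Box$: $\Gamma,\varphi\mathbin{\Box\!\!\rightarrow}\psi\Rightarrow\varphi$, $\Gamma,\varphi\mathbin{\Box\!\!\rightarrow}\psi,\psi\Rightarrow\Delta$ / $\Gamma,\varphi\mathbin{\Box\!\!\rightarrow}\psi\Rightarrow\Delta$; $mp_\Diamond$: $\Gamma\Rightarrow\varphi$, $\Gamma\Rightarrow\psi$ / $\Gamma\Rightarrow\varphi\mathbin{\Diamond\!\!\rightarrow}\psi$. Calculi (propositional rules plus): $\mathsf{S.ConstCKID}$: $\Box^{id},\Diamond^{id},\Box\Diamond^{id}$; $\mathsf{S.ConstCKMP}$: $\Box,\Diamond,\Box\Diamond,mp_\Box,mp_\Diamond$;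 $\mathsf{S.ConstCKMPID}$: $\Box^{id},\Diamond^{id},\Box\Diamond^{id},mp_\Box,mp_\Diamond$. -}

module Defs where

open import Data.Nat using (ℕ)
open import Data.List using (List; []; _∷_; _++_; map)
open import Data.List.Relation.Unary.All using (All)
open import Data.List.Relation.Binary.Permutation.Propositional using (_↭_)
open import Data.Maybe using (Maybe; just; nothing)
open import Data.Product using (_×_; _,_; proj₁; proj₂)

infixr 6 _∧_ _∨_
infixr 5 _⇒_ _□→_ _◇→_

data Fm : Set where
  at   : ℕ → Fm
  ⊥'   : Fm
  _∧_  : Fm → Fm → Fm
  _∨_  : Fm → Fm → Fm
  _⇒_  : Fm → Fm → Fm
  _□→_ : Fm → Fm → Fm
  _◇→_ : Fm → Fm → Fm

¬' : Fm → Fm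
¬' φ = φ ⇒ ⊥'

⊤' : Fm
⊤' = ¬' ⊥'

_⇔_ : Fm → Fm → Fm
φ ⇔ ψ = (φ ⇒ ψ) ∧ (ψ ⇒ φ)

data Star : Set where
  ID MP MPID : Star

data HasID : Star → Set where
  id-ID   : HasID ID
  id-MPID : HasID MPID

data HasMP : Star → Set where
  mp-MP   : HasMP MP
  mp-MPID : HasMP MPID

data Thm (s : Star) : Fm → Set where
  ax-K   : ∀ φ ψ → Thm s (φ ⇒ (ψ ⇒ φ))
  ax-S   : ∀ φ ψ χ → Thm s ((φ ⇒ (ψ ⇒ χ)) ⇒ ((φ ⇒ ψ) ⇒ (φ ⇒ χ)))
  ax-∧E₁ : ∀ φ ψ → Thm s (φ ∧ ψ ⇒ φ)
  ax-∧E₂ : ∀ φ ψ → Thm s (φ ∧ ψ ⇒ ψ)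
  ax-∧I  : ∀ φ ψ → Thm s (φ ⇒ (ψ ⇒ φ ∧ ψ))
  ax-∨I₁ : ∀ φ ψ → Thm s (φ ⇒ φ ∨ ψ)
  ax-∨I₂ : ∀ φ ψ → Thm s (ψ ⇒ φ ∨ ψ)
  ax-∨E  : ∀ φ ψ χ → Thm s ((φ ⇒ χ) ⇒ ((ψ ⇒ χ) ⇒ (φ ∨ ψ ⇒ χ)))
  ax-⊥E  : ∀ φ → Thm s (⊥' ⇒ φ)
  mp     : ∀ {φ ψ} → Thm s (φ ⇒ ψ) → Thm s φ → Thm s ψ
  CM□ : ∀ φ ψ χ → Thm s ((φ □→ ψ ∧ χ) ⇒ (φ □→ ψ) ∧ (φ □→ χ))
  CC□ : ∀ φ ψ χ → Thm s ((φ □→ ψ) ∧ (φ □→ χ) ⇒ (φ □→ ψ ∧ χ))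
  CN□ : ∀ φ → Thm s (φ □→ ⊤')
  CN◇ : ∀ φ → Thm s (¬' (φ ◇→ ⊥'))
  CK◇ : ∀ φ ψ χ → Thm s ((φ □→ (ψ ⇒ χ)) ⇒ ((φ ◇→ ψ) ⇒ (φ ◇→ χ)))
  RA□ : ∀ {φ ρ} ψ → Thm s (φ ⇔ ρ) → Thm s ((φ □→ ψ) ⇔ (ρ □→ ψ))
  RC□ : ∀ φ {ψ χ} → Thm s (ψ ⇔ χ) → Thm s ((φ □→ ψ) ⇔ (φ □→ χ))
  RA◇ : ∀ {φ ρ} ψ → Thm s (φ ⇔ ρ) → Thm s ((φ ◇→ ψ) ⇔ (ρ ◇→ ψ))
  RC◇ : ∀ φ {ψ χ} → Thm s (ψ ⇔ χ) → Thm s ((φ ◇→ ψ) ⇔ (φ ◇→ χ))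
  ID□ : HasID s → ∀ φ → Thm s (φ □→ φ)
  MP□ : HasMP s → ∀ φ ψ → Thm s ((φ □→ ψ) ⇒ (φ ⇒ ψ))
  MP◇ : HasMP s → ∀ φ ψ → Thm s (φ ∧ ψ ⇒ (φ ◇→ ψ))

-- Sequents: antecedent a finite multiset (a list taken up to permutation),
-- succedent Maybe Fm (|Δ| ≤ 1).

⋀ : List Fm → Fm
⋀ []           = ⊤'
⋀ (φ ∷ [])     = φ
⋀ (φ ∷ ψ ∷ Γ)  = φ ∧ ⋀ (ψ ∷ Γ)

⋁ : Maybe Fm → Fm
⋁ nothing  = ⊥'
⋁ (just φ) = φ

ι : List Fm → Maybe Fm → Fm
ι []       Δ = ⋁ Δ
ι (φ ∷ Γ)  Δ = ⋀ (φ ∷ Γ) ⇒ ⋁ Δ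

boxes : List (Fm × Fm) → List Fm
boxes P = map (λ p → proj₁ p □→ proj₂ p) P

sigmas : List (Fm × Fm) → List Fm
sigmas P = map proj₂ P

-- φ added to the last premiss in the id-variants of the rules
data Extra : Star → Fm → List Fm → Set where
  ex-ID   : ∀ {φ} → Extra ID φ (φ ∷ [])
  ex-MP   : ∀ {φ} → Extra MP φ []
  ex-MPID : ∀ {φ} → Extra MPID φ (φ ∷ [])

-- Sequent calculi S.ConstCK* ; every conclusion antecedent Γ' is required
-- to be (as a multiset) equal to the displayed one.
data Der (s : Star) : List Fm → Maybe Fm → Set where
  init : ∀ {Γ Γ'} p → Γ' ↭ (at p ∷ Γ) → Der s Γ' (just (at p))
  ⊥L   : ∀ {Γ Γ' Δ} → Γ' ↭ (⊥' ∷ Γ) → Der s Γ' Δ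
  ∧L   : ∀ {Γ Γ' Δ φ ψ} → Γ' ↭ (φ ∧ ψ ∷ Γ) →
         Der s (φ ∷ ψ ∷ Γ) Δ → Der s Γ' Δ
  ∧R   : ∀ {Γ φ ψ} → Der s Γ (just φ) → Der s Γ (just ψ) → Der s Γ (just (φ ∧ ψ))
  ∨L   : ∀ {Γ Γ' Δ φ ψ} → Γ' ↭ (φ ∨ ψ ∷ Γ) →
         Der s (φ ∷ Γ) Δ → Der s (ψ ∷ Γ) Δ → Der s Γ' Δ
  ∨R₁  : ∀ {Γ φ ψ} → Der s Γ (just φ) → Der s Γ (just (φ ∨ ψ))
  ∨R₂  : ∀ {Γ φ ψ} → Der s Γ (just ψ) → Der s Γ (just (φ ∨ ψ))
  ⇒R   : ∀ {Γ φ ψ} → Der s (φ ∷ Γ) (just ψ) → Der s Γ (just (φ ⇒ ψ))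
  ⇒L   : ∀ {Γ Γ' Δ φ ψ} → Γ' ↭ ((φ ⇒ ψ) ∷ Γ) →
         Der s ((φ ⇒ ψ) ∷ Γ) (just φ) → Der s (ψ ∷ Γ) Δ → Der s Γ' Δ
  □R   : ∀ {Γ Γ' X} (P : List (Fm × Fm)) φ ψ → Extra s φ X →
         Γ' ↭ (Γ ++ boxes P) →
         All (λ p → Der s (φ ∷ []) (just (proj₁ p)) × Der s (proj₁ p ∷ []) (just φ)) P →
         Der s (sigmas P ++ X) (just ψ) →
         Der s Γ' (just (φ □→ ψ))
  ◇R   : ∀ {Γ Γ' X} (P : List (Fm × Fm)) φ ψ η ϑ → Extra s φ X →
         Γ' ↭ (Γ ++ boxes P ++ ((φ ◇→ ψ) ∷ [])) →
         All (λ p → Der s (φ ∷ []) (just (proj₁ p)) × Der s (proj₁ p ∷ []) (just φ)) P →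
         Der s (φ ∷ []) (just η) → Der s (η ∷ []) (just φ) →
         Der s (sigmas P ++ X ++ (ψ ∷ [])) (just ϑ) →
         Der s Γ' (just (η ◇→ ϑ))
  □◇   : ∀ {Γ Γ' Δ X} (P : List (Fm × Fm)) φ ψ → Extra s φ X →
         Γ' ↭ (Γ ++ boxes P ++ ((φ ◇→ ψ) ∷ [])) →
         All (λ p → Der s (φ ∷ []) (just (proj₁ p)) × Der s (proj₁ p ∷ []) (just φ)) P →
         Der s (sigmas P ++ X ++ (ψ ∷ [])) nothing →
         Der s Γ' Δ
  mp□  : ∀ {Γ Γ' Δ φ ψ} → HasMP s → Γ' ↭ ((φ □→ ψ) ∷ Γ) →
         Der s ((φ □→ ψ) ∷ Γ) (just φ) → Der s ((φ □→ ψ) ∷ ψ ∷ Γ) Δ →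
         Der s Γ' Δ
  mp◇  : ∀ {Γ φ ψ} → HasMP s → Der s Γ (just φ) → Der s Γ (just ψ) →
         Der s Γ (just (φ ◇→ ψ))

module Submission where

-- Soundness: every rule of S.ConstCK* is simulated by Hilbert reasoning from hypotheses. The
-- modal rules say that φ □→ _ is closed under derivability (CM□, CC□, CN□), with the boxes
-- ρᵢ □→ σᵢ turned into φ □→ σᵢ by RA□, the extra φ of the id-variants supplied by ID□, and the
-- diamond rules coming from CK◇ and CN◇; the deduction theorem then yields ι(Γ ⇒ Δ).
-- Completeness: each axiom and rule of ConstCK* is derivable once cut is admissible. Cut is
-- eliminated syntactically, by induction on the cut formula and then on the derivations, using
-- invertibility of ∧L, ∨L and of the right premise of ⇒L together with contraction. In a
-- principal modal cut the boxes of the left premise take the place of the cut box (and the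
-- duplicated context is contracted away); against mp□ and mp◇ the boxes are discharged by mp□.

open import Defs
open import Data.Nat using (ℕ; suc; _+_; _≤_; _<_; s≤s)
open import Data.Nat.Properties using (≤-trans; ≤-refl; <-≤-trans; m≤m+n; m≤n+m)
open import Data.Empty using (⊥; ⊥-elim)
open import Data.Unit using (⊤)
open import Data.Sum using (_⊎_; inj₁; inj₂)
open import Data.Product using (_×_; _,_; proj₁; proj₂; ∃)
open import Data.Maybe using (Maybe; just; nothing)
open import Data.List using (List; []; _∷_; _++_; map; [_])
open import Data.List.Properties using (++-identityʳ; ++-assoc; map-++)
open import Data.List.Relation.Unary.All using (All; []; _∷_; lookup)
open import Data.List.Relation.Unary.All.Properties using (++⁺)
open import Data.List.Relation.Unary.Any using (here; there)
open import Data.List.Membership.Propositional using (_∈_)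
open import Data.List.Membership.Propositional.Properties
  using (∈-++⁻; ∈-++⁺ˡ; ∈-++⁺ʳ; ∈-map⁺; ∈-map⁻; ∈-∃++)
open import Data.List.Relation.Binary.Permutation.Propositional
  using (_↭_; prep; swap; ↭-refl; ↭-sym; ↭-trans; ↭-reflexive)
open import Data.List.Relation.Binary.Permutation.Propositional.Properties
  using (∈-resp-↭; All-resp-↭; shift; shifts; drop-∷; ++⁺ˡ; ++⁺ʳ; ++-comm; ++-commutativeMonoid; map⁺)
open import Relation.Binary.PropositionalEquality using (_≡_; refl; sym)
import Algebra.Solver.CommutativeMonoid (++-commutativeMonoid {A = Fm}) as ↭-Solver
open ↭-Solver using (solve; _⊕_; _⊜_)

infixr 4 _⟫_
_⟫_ : ∀ {A : Set} {xs ys zs : List A} → xs ↭ ys → ys ↭ zs → xs ↭ zs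
_⟫_ = ↭-trans

∈⇒↭ : ∀ {A : Set} {x : A} {xs} → x ∈ xs → ∃ λ ys → xs ↭ x ∷ ys
∈⇒↭ x∈xs with ∈-∃++ x∈xs
... | ys , zs , refl = ys ++ zs , shift _ ys zs

↭-∷-inv : ∀ {A : Set} {xs a b} {ys zs : List A} → xs ↭ a ∷ ys → xs ↭ b ∷ zs →
  (a ≡ b × ys ↭ zs) ⊎ ∃ λ ws → ys ↭ b ∷ ws × zs ↭ a ∷ ws
↭-∷-inv {a = a} {b} p q with ∈-resp-↭ (↭-sym q ⟫ p) (here refl)
... | here refl = inj₁ (refl , drop-∷ (↭-sym p ⟫ q))
... | there b∈ys with ∈⇒↭ b∈ys
...   | ws , r = inj₂ (ws , r , drop-∷ (↭-sym q ⟫ p ⟫ prep a r ⟫ swap a b ↭-refl))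

↭-∷∷-inv : ∀ {A : Set} {xs a b} {ys zs : List A} → xs ↭ a ∷ a ∷ ys → xs ↭ b ∷ zs →
  (a ≡ b × zs ↭ a ∷ ys) ⊎ ∃ λ ws → ys ↭ b ∷ ws × zs ↭ a ∷ a ∷ ws
↭-∷∷-inv p q with ↭-∷-inv p q
... | inj₁ (refl , r) = inj₁ (refl , ↭-sym r)
... | inj₂ (ws , r₁ , r₂) with ↭-∷-inv ↭-refl r₁
...   | inj₁ (refl , r₃) = inj₁ (refl , r₂ ⟫ prep _ (↭-sym r₃))
...   | inj₂ (vs , r₃ , r₄) = inj₂ (vs , r₃ , r₂ ⟫ prep _ r₄)

↭-++-∷ : ∀ {A : Set} {xs ys : List A} {x} zs → xs ↭ x ∷ ys → zs ++ xs ↭ x ∷ zs ++ ys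
↭-++-∷ {x = x} zs r = ++⁺ˡ zs r ⟫ shift x zs _

↭-++-∷∷ : ∀ {A : Set} {xs ys : List A} {x y} zs → xs ↭ x ∷ y ∷ ys → zs ++ xs ↭ x ∷ y ∷ zs ++ ys
↭-++-∷∷ {x = x} {y} zs r = ++⁺ˡ zs r ⟫ shifts zs (x ∷ y ∷ [])

↭-++-[] : ∀ {A : Set} (xs : List A) → xs ↭ xs ++ []
↭-++-[] xs = ↭-reflexive (sym (++-identityʳ xs))

box : Fm × Fm → Fm
box p = proj₁ p □→ proj₂ p

-- Where an occurrence of a formula sits in the context G ++ boxes P (rule □R), resp.
-- G ++ boxes P ++ [ δ ] (rules ◇R and □◇); Γ is the context with that occurrence removed.
data □Occurrence (Γ G : List Fm) (P : List (Fm × Fm)) : Fm → Set where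
  in-side  : ∀ {a} G' → Γ ↭ G' ++ boxes P → □Occurrence Γ G P a
  in-boxes : ∀ ρ σ P' → P ↭ (ρ , σ) ∷ P' → Γ ↭ G ++ boxes P' → □Occurrence Γ G P (ρ □→ σ)

data ◇Occurrence (Γ G : List Fm) (P : List (Fm × Fm)) (δ : Fm) : Fm → Set where
  in-side    : ∀ {a} G' → Γ ↭ G' ++ boxes P ++ [ δ ] → ◇Occurrence Γ G P δ a
  in-boxes   : ∀ ρ σ P' → P ↭ (ρ , σ) ∷ P' → Γ ↭ G ++ boxes P' ++ [ δ ] →
               ◇Occurrence Γ G P δ (ρ □→ σ)
  in-diamond : Γ ↭ G ++ boxes P → ◇Occurrence Γ G P δ δ

locate□ : ∀ {Θ a Γ} G P → Θ ↭ a ∷ Γ → Θ ↭ G ++ boxes P → □Occurrence Γ G P a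
locate□ G P q e with ∈-++⁻ G (∈-resp-↭ (↭-sym q ⟫ e) (here refl))
... | inj₁ a∈G with ∈⇒↭ a∈G
...   | G' , r = in-side G' (drop-∷ (↭-sym q ⟫ e ⟫ ++⁺ʳ _ r))
locate□ G P q e | inj₂ a∈P with ∈-map⁻ box a∈P
... | (ρ , σ) , p∈P , refl with ∈⇒↭ p∈P
...   | P' , r = in-boxes ρ σ P' r (drop-∷ (↭-sym q ⟫ e ⟫ ↭-++-∷ G (map⁺ box r)))

locate◇ : ∀ {Θ a Γ} G P δ → Θ ↭ a ∷ Γ → Θ ↭ G ++ boxes P ++ [ δ ] → ◇Occurrence Γ G P δ a
locate◇ G P δ q e with ∈-++⁻ G (∈-resp-↭ (↭-sym q ⟫ e) (here refl))
... | inj₁ a∈G with ∈⇒↭ a∈G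
...   | G' , r = in-side G' (drop-∷ (↭-sym q ⟫ e ⟫ ++⁺ʳ _ r))
locate◇ G P δ q e | inj₂ a∈R with ∈-++⁻ (boxes P) a∈R
... | inj₂ (here refl) = in-diamond (drop-∷ (↭-sym q ⟫ e ⟫ ↭-++-∷ G (++-comm (boxes P) [ δ ])))
... | inj₁ a∈P with ∈-map⁻ box a∈P
...   | (ρ , σ) , p∈P , refl with ∈⇒↭ p∈P
...     | P' , r = in-boxes ρ σ P' r (drop-∷ (↭-sym q ⟫ e ⟫ ↭-++-∷ G (++⁺ʳ [ δ ] (map⁺ box r))))

extra : ∀ s φ → ∃ (Extra s φ)
extra ID   φ = _ , ex-ID
extra MP   φ = _ , ex-MP
extra MPID φ = _ , ex-MPID

extra-cases : ∀ {s φ X} → Extra s φ X → X ≡ [] ⊎ (HasID s × X ≡ [ φ ])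
extra-cases ex-ID   = inj₂ (id-ID , refl)
extra-cases ex-MP   = inj₁ refl
extra-cases ex-MPID = inj₂ (id-MPID , refl)

extra-id : ∀ {s φ X} → HasID s → Extra s φ X → X ≡ [ φ ]
extra-id id-ID   ex-ID   = refl
extra-id id-MPID ex-MPID = refl

extra-uniform : ∀ {s φ₁ φ₂ X₁ X₂} → Extra s φ₁ X₁ → Extra s φ₂ X₂ →
  (X₁ ≡ [] × X₂ ≡ []) ⊎ (X₁ ≡ [ φ₁ ] × X₂ ≡ [ φ₂ ])
extra-uniform ex-ID   ex-ID   = inj₂ (refl , refl)
extra-uniform ex-MP   ex-MP   = inj₁ (refl , refl)
extra-uniform ex-MPID ex-MPID = inj₂ (refl , refl)

size : Fm → ℕ
size (at _)   = 1
size ⊥'       = 1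
size (φ ∧ ψ)  = suc (size φ + size ψ)
size (φ ∨ ψ)  = suc (size φ + size ψ)
size (φ ⇒ ψ)  = suc (size φ + size ψ)
size (φ □→ ψ) = suc (size φ + size ψ)
size (φ ◇→ ψ) = suc (size φ + size ψ)

1+m+n≤o⇒m<o : ∀ {m n o} → suc (m + n) ≤ o → m < o
1+m+n≤o⇒m<o {m} {n} h = ≤-trans (s≤s (m≤m+n m n)) h

1+m+n≤o⇒n<o : ∀ {m n o} → suc (m + n) ≤ o → n < o
1+m+n≤o⇒n<o {m} {n} h = ≤-trans (s≤s (m≤n+m n m)) h

module Structural (s : Star) where

  Equiv : Fm → List (Fm × Fm) → Set
  Equiv φ P = All (λ p → Der s [ φ ] (just (proj₁ p)) × Der s [ proj₁ p ] (just φ)) P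

  exchange : ∀ {Γ Γ' Δ} → Der s Γ Δ → Γ ↭ Γ' → Der s Γ' Δ
  exchange (init p q)     e = init p (↭-sym e ⟫ q)
  exchange (⊥L q)         e = ⊥L (↭-sym e ⟫ q)
  exchange (∧L q d)       e = ∧L (↭-sym e ⟫ q) d
  exchange (∧R d d')      e = ∧R (exchange d e) (exchange d' e)
  exchange (∨L q d d')    e = ∨L (↭-sym e ⟫ q) d d'
  exchange (∨R₁ d)        e = ∨R₁ (exchange d e)
  exchange (∨R₂ d)        e = ∨R₂ (exchange d e)
  exchange (⇒R d)         e = ⇒R (exchange d (prep _ e))
  exchange (⇒L q d d')    e = ⇒L (↭-sym e ⟫ q) d d'
  exchange (□R {Γ = G} P φ ψ x q a d) e = □R {Γ = G} P φ ψ x (↭-sym e ⟫ q) a d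
  exchange (◇R {Γ = G} P φ ψ η ϑ x q a d₁ d₂ d) e = ◇R {Γ = G} P φ ψ η ϑ x (↭-sym e ⟫ q) a d₁ d₂ d
  exchange (□◇ {Γ = G} P φ ψ x q a d) e = □◇ {Γ = G} P φ ψ x (↭-sym e ⟫ q) a d
  exchange (mp□ h q d d') e = mp□ h (↭-sym e ⟫ q) d d'
  exchange (mp◇ h d d')   e = mp◇ h (exchange d e) (exchange d' e)

  weakenʳ : ∀ {Γ Δ} Θ → Der s Γ Δ → Der s (Γ ++ Θ) Δ
  weakenʳ Θ (init p q)     = init p (++⁺ʳ Θ q)
  weakenʳ Θ (⊥L q)         = ⊥L (++⁺ʳ Θ q)
  weakenʳ Θ (∧L q d)       = ∧L (++⁺ʳ Θ q) (weakenʳ Θ d)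
  weakenʳ Θ (∧R d d')      = ∧R (weakenʳ Θ d) (weakenʳ Θ d')
  weakenʳ Θ (∨L q d d')    = ∨L (++⁺ʳ Θ q) (weakenʳ Θ d) (weakenʳ Θ d')
  weakenʳ Θ (∨R₁ d)        = ∨R₁ (weakenʳ Θ d)
  weakenʳ Θ (∨R₂ d)        = ∨R₂ (weakenʳ Θ d)
  weakenʳ Θ (⇒R d)         = ⇒R (weakenʳ Θ d)
  weakenʳ Θ (⇒L q d d')    = ⇒L (++⁺ʳ Θ q) (weakenʳ Θ d) (weakenʳ Θ d')
  weakenʳ Θ (□R {Γ = G} P φ ψ x q a d) =
    □R {Γ = G ++ Θ} P φ ψ x
      (++⁺ʳ Θ q ⟫ solve 3 (λ g b t → ((g ⊕ b) ⊕ t) ⊜ ((g ⊕ t) ⊕ b)) ↭-refl G (boxes P) Θ) a d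
  weakenʳ Θ (◇R {Γ = G} P φ ψ η ϑ x q a d₁ d₂ d) =
    ◇R {Γ = G ++ Θ} P φ ψ η ϑ x
      (++⁺ʳ Θ q ⟫ solve 4 (λ g b c t → ((g ⊕ b ⊕ c) ⊕ t) ⊜ ((g ⊕ t) ⊕ b ⊕ c)) ↭-refl G (boxes P) [ φ ◇→ ψ ] Θ)
      a d₁ d₂ d
  weakenʳ Θ (□◇ {Γ = G} P φ ψ x q a d) =
    □◇ {Γ = G ++ Θ} P φ ψ x
      (++⁺ʳ Θ q ⟫ solve 4 (λ g b c t → ((g ⊕ b ⊕ c) ⊕ t) ⊜ ((g ⊕ t) ⊕ b ⊕ c)) ↭-refl G (boxes P) [ φ ◇→ ψ ] Θ)
      a d
  weakenʳ Θ (mp□ h q d d') = mp□ h (++⁺ʳ Θ q) (weakenʳ Θ d) (weakenʳ Θ d')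
  weakenʳ Θ (mp◇ h d d')   = mp◇ h (weakenʳ Θ d) (weakenʳ Θ d')

  weakenˡ : ∀ {Γ Δ} Θ → Der s Γ Δ → Der s (Θ ++ Γ) Δ
  weakenˡ {Γ} Θ d = exchange (weakenʳ Θ d) (++-comm Γ Θ)

  weaken : ∀ {Γ Δ} φ → Der s Γ Δ → Der s (φ ∷ Γ) Δ
  weaken φ = weakenˡ [ φ ]

  weaken-succedent : ∀ {Γ Δ} → Der s Γ nothing → Der s Γ Δ
  weaken-succedent (⊥L q)      = ⊥L q
  weaken-succedent (∧L q d)    = ∧L q (weaken-succedent d)
  weaken-succedent (∨L q d d') = ∨L q (weaken-succedent d) (weaken-succedent d')
  weaken-succedent (⇒L q d d') = ⇒L q d (weaken-succedent d')
  weaken-succedent (□◇ {Γ = G} P φ ψ x q a d) = □◇ {Γ = G} P φ ψ x q a d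
  weaken-succedent (mp□ h q d d') = mp□ h q d (weaken-succedent d')

  identity : ∀ φ {Γ} → Der s (φ ∷ Γ) (just φ)
  identity (at p)   = init p ↭-refl
  identity ⊥'       = ⊥L ↭-refl
  identity (φ ∧ ψ)  = ∧L ↭-refl (∧R (identity φ) (weaken φ (identity ψ)))
  identity (φ ∨ ψ)  = ∨L ↭-refl (∨R₁ (identity φ)) (∨R₂ (identity ψ))
  identity (φ ⇒ ψ)  = ⇒R (⇒L (swap _ _ ↭-refl) (weaken (φ ⇒ ψ) (identity φ)) (identity ψ))
  identity (φ □→ ψ) {Γ} =
    □R {Γ = Γ} [ (φ , ψ) ] φ ψ (proj₂ (extra s φ)) (++-comm [ φ □→ ψ ] Γ)
      ((identity φ , identity φ) ∷ []) (identity ψ)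
  identity (φ ◇→ ψ) {Γ} with extra s φ
  ... | X , x = ◇R {Γ = Γ} [] φ ψ φ ψ x (++-comm [ φ ◇→ ψ ] Γ) [] (identity φ) (identity φ)
                  (exchange (identity ψ) (++-comm [ ψ ] X))

Compound : Fm → Set
Compound (_ ∧ _) = ⊤
Compound (_ ∨ _) = ⊤
Compound (_ ⇒ _) = ⊤
Compound _       = ⊥

++-side : ∀ {Γ R : List Fm} L G → Γ ↭ G ++ R → L ++ Γ ↭ (L ++ G) ++ R
++-side {R = R} L G r = ++⁺ˡ L r ⟫ ↭-reflexive (sym (++-assoc L G R))

◇-context : ∀ {Γ δ} G B → Γ ↭ G ++ B → δ ∷ Γ ↭ G ++ B ++ [ δ ]
◇-context {δ = δ} G B r = prep δ r ⟫ solve 3 (λ d g b → (d ⊕ g ⊕ b) ⊜ (g ⊕ b ⊕ d)) ↭-refl [ δ ] G B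

module Inversion (s : Star) where
  open Structural s

  LeftPremises : Fm → List Fm → Maybe Fm → Set
  LeftPremises (α ∧ β) Γ Δ = Der s (α ∷ β ∷ Γ) Δ
  LeftPremises (α ∨ β) Γ Δ = Der s (α ∷ Γ) Δ × Der s (β ∷ Γ) Δ
  LeftPremises (α ⇒ β) Γ Δ = Der s ((α ⇒ β) ∷ Γ) (just α) × Der s (β ∷ Γ) Δ
  LeftPremises _       Γ Δ = ⊤

  -- A compound formula is never principal in a modal rule, so it is either principal in its
  -- left rule (handled by `principal`) or passive, and then the rule commutes with the inversion.
  invert-left : ∀ {A} L → Compound A → (principal : ∀ {Γ Δ} → LeftPremises A Γ Δ → Der s (L ++ Γ) Δ) →
                ∀ {Θ Γ Δ} → Der s Θ Δ → Θ ↭ A ∷ Γ → Der s (L ++ Γ) Δ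
  invert-left L c principal (init p e) q with ↭-∷-inv q e
  ... | inj₁ (refl , _)    = ⊥-elim c
  ... | inj₂ (Λ , r , _)   = init p (↭-++-∷ L r)
  invert-left L c principal (⊥L e) q with ↭-∷-inv q e
  ... | inj₁ (refl , _)    = ⊥-elim c
  ... | inj₂ (Λ , r , _)   = ⊥L (↭-++-∷ L r)
  invert-left L c principal (∧L {φ = α} {β} e d) q with ↭-∷-inv q e
  ... | inj₁ (refl , r) = principal (exchange d (prep α (prep β (↭-sym r))))
  ... | inj₂ (Λ , r₁ , r₂) =
    ∧L (↭-++-∷ L r₁) (exchange (invert-left L c principal d (↭-++-∷ (α ∷ β ∷ []) r₂)) (shifts L (α ∷ β ∷ [])))
  invert-left L c principal (∨L {φ = α} {β} e d d') q with ↭-∷-inv q e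
  ... | inj₁ (refl , r) = principal (exchange d (prep α (↭-sym r)) , exchange d' (prep β (↭-sym r)))
  ... | inj₂ (Λ , r₁ , r₂) =
    ∨L (↭-++-∷ L r₁) (exchange (invert-left L c principal d (↭-++-∷ [ α ] r₂)) (shifts L [ α ]))
                     (exchange (invert-left L c principal d' (↭-++-∷ [ β ] r₂)) (shifts L [ β ]))
  invert-left L c principal (⇒L {φ = α} {β} e d d') q with ↭-∷-inv q e
  ... | inj₁ (refl , r) = principal (exchange d (prep _ (↭-sym r)) , exchange d' (prep β (↭-sym r)))
  ... | inj₂ (Λ , r₁ , r₂) =
    ⇒L (↭-++-∷ L r₁) (exchange (invert-left L c principal d (↭-++-∷ [ α ⇒ β ] r₂)) (shifts L [ α ⇒ β ]))
                     (exchange (invert-left L c principal d' (↭-++-∷ [ β ] r₂)) (shifts L [ β ]))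
  invert-left L c principal (mp□ {φ = φ} {ψ} h e d d') q with ↭-∷-inv q e
  ... | inj₁ (refl , _) = ⊥-elim c
  ... | inj₂ (Λ , r₁ , r₂) =
    mp□ h (↭-++-∷ L r₁)
      (exchange (invert-left L c principal d (↭-++-∷ [ φ □→ ψ ] r₂)) (shifts L [ φ □→ ψ ]))
      (exchange (invert-left L c principal d' (↭-++-∷ ((φ □→ ψ) ∷ ψ ∷ []) r₂)) (shifts L ((φ □→ ψ) ∷ ψ ∷ [])))
  invert-left L c principal (∧R d d')  q = ∧R (invert-left L c principal d q) (invert-left L c principal d' q)
  invert-left L c principal (∨R₁ d)    q = ∨R₁ (invert-left L c principal d q)
  invert-left L c principal (∨R₂ d)    q = ∨R₂ (invert-left L c principal d q)
  invert-left L c principal (mp◇ h d d') q = mp◇ h (invert-left L c principal d q) (invert-left L c principal d' q)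
  invert-left L c principal (⇒R {φ = φ} d) q =
    ⇒R (exchange (invert-left L c principal d (↭-++-∷ [ φ ] q)) (shifts L [ φ ]))
  invert-left L c principal (□R {Γ = G} P φ ψ x e a d) q with locate□ G P q e
  ... | in-side G' r         = □R {Γ = L ++ G'} P φ ψ x (++-side L G' r) a d
  ... | in-boxes _ _ _ _ _   = ⊥-elim c
  invert-left L c principal (◇R {Γ = G} P φ ψ η ϑ x e a d₁ d₂ d) q with locate◇ G P (φ ◇→ ψ) q e
  ... | in-side G' r         = ◇R {Γ = L ++ G'} P φ ψ η ϑ x (++-side L G' r) a d₁ d₂ d
  ... | in-boxes _ _ _ _ _   = ⊥-elim c
  ... | in-diamond _         = ⊥-elim c
  invert-left L c principal (□◇ {Γ = G} P φ ψ x e a d) q with locate◇ G P (φ ◇→ ψ) q e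
  ... | in-side G' r         = □◇ {Γ = L ++ G'} P φ ψ x (++-side L G' r) a d
  ... | in-boxes _ _ _ _ _   = ⊥-elim c
  ... | in-diamond _         = ⊥-elim c

  ∧L-inv : ∀ {α β Θ Γ Δ} → Der s Θ Δ → Θ ↭ (α ∧ β) ∷ Γ → Der s (α ∷ β ∷ Γ) Δ
  ∧L-inv {α} {β} = invert-left (α ∷ β ∷ []) _ (λ d → d)

  ∨L-inv₁ : ∀ {α β Θ Γ Δ} → Der s Θ Δ → Θ ↭ (α ∨ β) ∷ Γ → Der s (α ∷ Γ) Δ
  ∨L-inv₁ {α} = invert-left [ α ] _ proj₁

  ∨L-inv₂ : ∀ {α β Θ Γ Δ} → Der s Θ Δ → Θ ↭ (α ∨ β) ∷ Γ → Der s (β ∷ Γ) Δ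
  ∨L-inv₂ {β = β} = invert-left [ β ] _ proj₂

  ⇒L-inv : ∀ {α β Θ Γ Δ} → Der s Θ Δ → Θ ↭ (α ⇒ β) ∷ Γ → Der s (β ∷ Γ) Δ
  ⇒L-inv {β = β} = invert-left [ β ] _ proj₂

module Contraction (s : Star) where
  open Structural s
  open Inversion s

  Contractible : Fm → Set
  Contractible A = ∀ {Θ Γ Δ} → Der s Θ Δ → Θ ↭ A ∷ A ∷ Γ → Der s (A ∷ Γ) Δ

  merge-duplicate-box : ∀ {ρ σ φ P P' P'' Y Δ} → Contractible σ →
    P ↭ (ρ , σ) ∷ P' → P' ↭ (ρ , σ) ∷ P'' → Equiv φ P → Der s (sigmas P ++ Y) Δ →
    Equiv φ ((ρ , σ) ∷ P'') × Der s (sigmas ((ρ , σ) ∷ P'') ++ Y) Δ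
  merge-duplicate-box {σ = σ} {Y = Y} contract r r' eqs d with All-resp-↭ r eqs
  ... | e ∷ eqs' with All-resp-↭ r' eqs'
  ...   | _ ∷ eqs'' = e ∷ eqs'' , contract d (++⁺ʳ Y (map⁺ proj₂ r ⟫ prep σ (map⁺ proj₂ r')))

  -- Two copies of A in the context of a modal rule: if one is a side formula drop it, if both
  -- belong to the boxes ρ □→ σ of the rule, merge them and contract σ in the premise.
  contract-□context : ∀ {A Γ Θ G P φ Y Δ Δ'} → (∀ {B} → size B < size A → Contractible B) →
    Θ ↭ G ++ boxes P → Θ ↭ A ∷ A ∷ Γ → Equiv φ P → Der s (sigmas P ++ Y) Δ' →
    (∀ {G' P'} → A ∷ Γ ↭ G' ++ boxes P' → Equiv φ P' → Der s (sigmas P' ++ Y) Δ' → Der s (A ∷ Γ) Δ) →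
    Der s (A ∷ Γ) Δ
  contract-□context {G = G} {P} IH e q a d rule with locate□ G P q e
  ... | in-side G' r = rule r a d
  ... | in-boxes ρ σ P' r₁ r₂ with locate□ G P' ↭-refl r₂
  ...   | in-side G' r₃ = rule (prep _ r₃ ⟫ ↭-sym (↭-++-∷ G' (map⁺ box r₁))) a d
  ...   | in-boxes _ _ P'' r₁' r₂' with merge-duplicate-box (IH (1+m+n≤o⇒n<o ≤-refl)) r₁ r₁' a d
  ...     | a' , d' = rule (prep _ r₂' ⟫ ↭-sym (shift _ G _)) a' d'

  contract-◇context : ∀ {A Γ Θ G P φ χ Y Δ Δ'} → (∀ {B} → size B < size A → Contractible B) →
    Θ ↭ G ++ boxes P ++ [ φ ◇→ χ ] → Θ ↭ A ∷ A ∷ Γ → Equiv φ P → Der s (sigmas P ++ Y) Δ' →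
    (∀ {G' P'} → A ∷ Γ ↭ G' ++ boxes P' ++ [ φ ◇→ χ ] → Equiv φ P' → Der s (sigmas P' ++ Y) Δ' → Der s (A ∷ Γ) Δ) →
    Der s (A ∷ Γ) Δ
  contract-◇context {G = G} {P} {φ = φ} {χ} IH e q a d rule with locate◇ G P (φ ◇→ χ) q e
  ... | in-side G' r = rule {G'} {P} r a d
  ... | in-boxes ρ σ P' r₁ r₂ with locate◇ G P' (φ ◇→ χ) ↭-refl r₂
  ...   | in-side G' r₃ = rule {G'} {P} (prep _ r₃ ⟫ ↭-sym (↭-++-∷ G' (++⁺ʳ [ φ ◇→ χ ] (map⁺ box r₁)))) a d
  ...   | in-boxes _ _ P'' r₁' r₂' with merge-duplicate-box (IH (1+m+n≤o⇒n<o ≤-refl)) r₁ r₁' a d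
  ...     | a' , d' = rule {G} {(ρ , σ) ∷ P''} (prep _ r₂' ⟫ ↭-sym (shift _ G _)) a' d'
  contract-◇context {G = G} {P} {φ = φ} {χ} IH e q a d rule | in-diamond r₂ with locate□ G P ↭-refl r₂
  ... | in-side G' r₃ = rule {G'} {P} (◇-context G' (boxes P) r₃) a d

  contract-∧ : ∀ {α β Γ₀ Γ Δ} → Contractible α → Contractible β →
               Der s (α ∷ β ∷ Γ₀) Δ → Γ₀ ↭ (α ∧ β) ∷ Γ → Der s ((α ∧ β) ∷ Γ) Δ
  contract-∧ {α} {β} {Γ = Γ} contract-α contract-β d r = ∧L ↭-refl (exchange βαΓ (swap β α ↭-refl))
    where
    αβαβΓ : Der s (α ∷ β ∷ α ∷ β ∷ Γ) _
    αβαβΓ = ∧L-inv d (↭-++-∷ (α ∷ β ∷ []) r)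
    αββΓ : Der s (α ∷ β ∷ β ∷ Γ) _
    αββΓ = contract-α αβαβΓ (prep α (swap β α ↭-refl))
    βαΓ : Der s (β ∷ α ∷ Γ) _
    βαΓ = contract-β αββΓ (shifts [ α ] (β ∷ β ∷ []))

  contract-∨ : ∀ {α β Γ₀ Γ Δ} → Contractible α → Contractible β →
               Der s (α ∷ Γ₀) Δ → Der s (β ∷ Γ₀) Δ → Γ₀ ↭ (α ∨ β) ∷ Γ → Der s ((α ∨ β) ∷ Γ) Δ
  contract-∨ {α} {β} contract-α contract-β d d' r =
    ∨L ↭-refl (contract-α (∨L-inv₁ d (↭-++-∷ [ α ] r)) ↭-refl)
              (contract-β (∨L-inv₂ d' (↭-++-∷ [ β ] r)) ↭-refl)

  contraction : ∀ n {A} → size A < n → Contractible A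
  contraction (suc n) {A} (s≤s sz) = contract
    where
    IH : ∀ {B} → size B < size A → Contractible B
    IH lt = contraction n (<-≤-trans lt sz)

    contract : Contractible A
    contract (init p e) q with ↭-∷∷-inv q e
    ... | inj₁ (refl , _)  = init p ↭-refl
    ... | inj₂ (Λ , r , _) = init p (↭-++-∷ [ A ] r)
    contract (⊥L e) q with ↭-∷∷-inv q e
    ... | inj₁ (refl , _)  = ⊥L ↭-refl
    ... | inj₂ (Λ , r , _) = ⊥L (↭-++-∷ [ A ] r)
    contract (∧L {φ = α} {β} e d) q with ↭-∷∷-inv q e
    ... | inj₁ (refl , r) = contract-∧ (IH (1+m+n≤o⇒m<o ≤-refl)) (IH (1+m+n≤o⇒n<o ≤-refl)) d r
    ... | inj₂ (Λ , r₁ , r₂) =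
      ∧L (↭-++-∷ [ A ] r₁) (exchange (contract d (↭-++-∷∷ (α ∷ β ∷ []) r₂)) (shifts [ A ] (α ∷ β ∷ [])))
    contract (∨L {φ = α} {β} e d d') q with ↭-∷∷-inv q e
    ... | inj₁ (refl , r) = contract-∨ (IH (1+m+n≤o⇒m<o ≤-refl)) (IH (1+m+n≤o⇒n<o ≤-refl)) d d' r
    ... | inj₂ (Λ , r₁ , r₂) =
      ∨L (↭-++-∷ [ A ] r₁) (exchange (contract d (↭-++-∷∷ [ α ] r₂)) (shifts [ A ] [ α ]))
                           (exchange (contract d' (↭-++-∷∷ [ β ] r₂)) (shifts [ A ] [ β ]))
    contract (⇒L {φ = α} {β} e d d') q with ↭-∷∷-inv q e
    ... | inj₁ (refl , r) =
      ⇒L ↭-refl (contract d (prep A r)) (IH (1+m+n≤o⇒n<o ≤-refl) (⇒L-inv d' (↭-++-∷ [ β ] r)) ↭-refl)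
    ... | inj₂ (Λ , r₁ , r₂) =
      ⇒L (↭-++-∷ [ A ] r₁) (exchange (contract d (↭-++-∷∷ [ α ⇒ β ] r₂)) (shifts [ A ] [ α ⇒ β ]))
                           (exchange (contract d' (↭-++-∷∷ [ β ] r₂)) (shifts [ A ] [ β ]))
    contract (mp□ {φ = φ} {ψ} h e d d') q with ↭-∷∷-inv q e
    ... | inj₁ (refl , r) = mp□ h ↭-refl (contract d (prep A r)) (contract d' (prep A (↭-++-∷ [ ψ ] r)))
    ... | inj₂ (Λ , r₁ , r₂) =
      mp□ h (↭-++-∷ [ A ] r₁)
        (exchange (contract d (↭-++-∷∷ [ φ □→ ψ ] r₂)) (shifts [ A ] [ φ □→ ψ ]))
        (exchange (contract d' (↭-++-∷∷ ((φ □→ ψ) ∷ ψ ∷ []) r₂)) (shifts [ A ] ((φ □→ ψ) ∷ ψ ∷ [])))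
    contract (∧R d d')     q = ∧R (contract d q) (contract d' q)
    contract (∨R₁ d)       q = ∨R₁ (contract d q)
    contract (∨R₂ d)       q = ∨R₂ (contract d q)
    contract (mp◇ h d d')  q = mp◇ h (contract d q) (contract d' q)
    contract (⇒R {φ = φ} d) q = ⇒R (exchange (contract d (↭-++-∷∷ [ φ ] q)) (swap A φ ↭-refl))
    contract (□R P φ ψ x e a d) q =
      contract-□context IH e q a d (λ {G'} {P'} r a' d' → □R {Γ = G'} P' φ ψ x r a' d')
    contract (◇R {Γ = G} P φ ψ η ϑ x e a d₁ d₂ d) q =
      contract-◇context {G = G} IH e q a d (λ {G'} {P'} r a' d' → ◇R {Γ = G'} P' φ ψ η ϑ x r a' d₁ d₂ d')
    contract (□◇ {Γ = G} P φ ψ x e a d) q =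
      contract-◇context {G = G} IH e q a d (λ {G'} {P'} r a' d' → □◇ {Γ = G'} P' φ ψ x r a' d')

  contract : ∀ {A Θ Γ Δ} → Der s Θ Δ → Θ ↭ A ∷ A ∷ Γ → Der s (A ∷ Γ) Δ
  contract {A} = contraction (suc (size A)) ≤-refl

  contract-++ : ∀ {Γ Δ} L {Λ} → Der s (Γ ++ L) Δ → Γ ↭ Λ ++ L → Der s Γ Δ
  contract-++ {Γ} [] d e = exchange d (↭-reflexive (++-identityʳ Γ))
  contract-++ {Γ} (x ∷ L) {Λ} d e =
    exchange (contract xxΓ (prep x e')) (↭-sym e')
    where
    e' : Γ ↭ x ∷ Λ ++ L
    e' = e ⟫ shift x Λ L
    xxΓ : Der s (x ∷ Γ) _
    xxΓ = contract-++ {x ∷ Γ} L {x ∷ x ∷ Λ} (exchange d (shift x Γ L)) (prep x e')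

boxes-++ : ∀ P Q → boxes (P ++ Q) ↭ boxes P ++ boxes Q
boxes-++ P Q = ↭-reflexive (map-++ box P Q)

sigmas-++ : ∀ P Q → sigmas (P ++ Q) ↭ sigmas P ++ sigmas Q
sigmas-++ P Q = ↭-reflexive (map-++ proj₂ P Q)

boxes-prepend-□ : ∀ {Γ} G Q R → Γ ↭ G ++ boxes Q → Γ ++ boxes R ↭ G ++ boxes (R ++ Q)
boxes-prepend-□ G Q R r =
  ++⁺ʳ (boxes R) r ⟫ solve 3 (λ g q r → ((g ⊕ q) ⊕ r) ⊜ (g ⊕ r ⊕ q)) ↭-refl G (boxes Q) (boxes R)
  ⟫ ++⁺ˡ G (↭-sym (boxes-++ R Q))

boxes-prepend-◇ : ∀ {Γ δ} G Q R → Γ ↭ G ++ boxes Q ++ [ δ ] → Γ ++ boxes R ↭ G ++ boxes (R ++ Q) ++ [ δ ]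
boxes-prepend-◇ {δ = δ} G Q R r =
  ++⁺ʳ (boxes R) r ⟫ solve 4 (λ g q d r → ((g ⊕ q ⊕ d) ⊕ r) ⊜ (g ⊕ (r ⊕ q) ⊕ d)) ↭-refl G (boxes Q) [ δ ] (boxes R)
  ⟫ ++⁺ˡ G (++⁺ʳ [ δ ] (↭-sym (boxes-++ R Q)))

boxes-append-◇ : ∀ {Γ δ} G Q R → Γ ↭ G ++ boxes Q ++ [ δ ] → Γ ++ boxes R ↭ G ++ boxes (Q ++ R) ++ [ δ ]
boxes-append-◇ {δ = δ} G Q R r =
  ++⁺ʳ (boxes R) r ⟫ solve 4 (λ g q d r → ((g ⊕ q ⊕ d) ⊕ r) ⊜ (g ⊕ (q ⊕ r) ⊕ d)) ↭-refl G (boxes Q) [ δ ] (boxes R)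
  ⟫ ++⁺ˡ G (++⁺ʳ [ δ ] (↭-sym (boxes-++ Q R)))

module Cut (s : Star) where
  open Structural s
  open Inversion s
  open Contraction s

  data RightIntro (Γ : List Fm) : Fm → Set where
    ∧R  : ∀ {φ ψ} → Der s Γ (just φ) → Der s Γ (just ψ) → RightIntro Γ (φ ∧ ψ)
    ∨R₁ : ∀ {φ ψ} → Der s Γ (just φ) → RightIntro Γ (φ ∨ ψ)
    ∨R₂ : ∀ {φ ψ} → Der s Γ (just ψ) → RightIntro Γ (φ ∨ ψ)
    ⇒R  : ∀ {φ ψ} → Der s (φ ∷ Γ) (just ψ) → RightIntro Γ (φ ⇒ ψ)
    □R  : ∀ {G X} P φ ψ → Extra s φ X → Γ ↭ G ++ boxes P → Equiv φ P →
          Der s (sigmas P ++ X) (just ψ) → RightIntro Γ (φ □→ ψ)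
    ◇R  : ∀ {G X} P φ ψ η ϑ → Extra s φ X → Γ ↭ G ++ boxes P ++ [ φ ◇→ ψ ] → Equiv φ P →
          Der s [ φ ] (just η) → Der s [ η ] (just φ) → Der s (sigmas P ++ X ++ [ ψ ]) (just ϑ) →
          RightIntro Γ (η ◇→ ϑ)
    mp◇ : ∀ {φ ψ} → HasMP s → Der s Γ (just φ) → Der s Γ (just ψ) → RightIntro Γ (φ ◇→ ψ)

  RI-exchange : ∀ {Γ Γ' A} → RightIntro Γ A → Γ ↭ Γ' → RightIntro Γ' A
  RI-exchange (∧R d d')   e = ∧R (exchange d e) (exchange d' e)
  RI-exchange (∨R₁ d)     e = ∨R₁ (exchange d e)
  RI-exchange (∨R₂ d)     e = ∨R₂ (exchange d e)
  RI-exchange (⇒R d)      e = ⇒R (exchange d (prep _ e))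
  RI-exchange (□R {G} P φ ψ x q a d) e = □R {G = G} P φ ψ x (↭-sym e ⟫ q) a d
  RI-exchange (◇R {G} P φ ψ η ϑ x q a d₁ d₂ d) e = ◇R {G = G} P φ ψ η ϑ x (↭-sym e ⟫ q) a d₁ d₂ d
  RI-exchange (mp◇ h d d') e = mp◇ h (exchange d e) (exchange d' e)

  RI-weaken : ∀ {Γ A} χ → RightIntro Γ A → RightIntro (χ ∷ Γ) A
  RI-weaken χ (∧R d d')   = ∧R (weaken χ d) (weaken χ d')
  RI-weaken χ (∨R₁ d)     = ∨R₁ (weaken χ d)
  RI-weaken χ (∨R₂ d)     = ∨R₂ (weaken χ d)
  RI-weaken χ (⇒R {φ = φ} d) = ⇒R (exchange (weaken χ d) (swap χ φ ↭-refl))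
  RI-weaken χ (□R {G} P φ ψ x q a d) = □R {G = χ ∷ G} P φ ψ x (prep χ q) a d
  RI-weaken χ (◇R {G} P φ ψ η ϑ x q a d₁ d₂ d) = ◇R {G = χ ∷ G} P φ ψ η ϑ x (prep χ q) a d₁ d₂ d
  RI-weaken χ (mp◇ h d d') = mp◇ h (weaken χ d) (weaken χ d')

  RI-invert : ∀ {Γ A x Λ} L → RightIntro Γ A → Γ ↭ x ∷ Λ → Compound x →
              (invert : ∀ {Δ} M → Der s (M ++ Γ) Δ → Der s (M ++ L ++ Λ) Δ) → RightIntro (L ++ Λ) A
  RI-invert L (∧R d d')   r c invert = ∧R (invert [] d) (invert [] d')
  RI-invert L (∨R₁ d)     r c invert = ∨R₁ (invert [] d)
  RI-invert L (∨R₂ d)     r c invert = ∨R₂ (invert [] d)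
  RI-invert L (⇒R {φ = φ} d) r c invert = ⇒R (invert [ φ ] d)
  RI-invert L (mp◇ h d d') r c invert = mp◇ h (invert [] d) (invert [] d')
  RI-invert L (□R {G} P φ ψ x q a d) r c invert with locate□ G P r q
  ... | in-side G' r'       = □R {G = L ++ G'} P φ ψ x (++-side L G' r') a d
  ... | in-boxes _ _ _ _ _ = ⊥-elim c
  RI-invert L (◇R {G} P φ ψ η ϑ x q a d₁ d₂ d) r c invert with locate◇ G P (φ ◇→ ψ) r q
  ... | in-side G' r'       = ◇R {G = L ++ G'} P φ ψ η ϑ x (++-side L G' r') a d₁ d₂ d
  ... | in-boxes _ _ _ _ _ = ⊥-elim c
  ... | in-diamond _       = ⊥-elim c

  invert-∧ : ∀ {α β Γ Λ Δ} → Γ ↭ (α ∧ β) ∷ Λ → ∀ M → Der s (M ++ Γ) Δ → Der s (M ++ α ∷ β ∷ Λ) Δ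
  invert-∧ {α} {β} r M d = exchange (∧L-inv d (↭-++-∷ M r)) (shifts (α ∷ β ∷ []) M)

  invert-∨₁ : ∀ {α β Γ Λ Δ} → Γ ↭ (α ∨ β) ∷ Λ → ∀ M → Der s (M ++ Γ) Δ → Der s (M ++ α ∷ Λ) Δ
  invert-∨₁ {α} r M d = exchange (∨L-inv₁ d (↭-++-∷ M r)) (shifts [ α ] M)

  invert-∨₂ : ∀ {α β Γ Λ Δ} → Γ ↭ (α ∨ β) ∷ Λ → ∀ M → Der s (M ++ Γ) Δ → Der s (M ++ β ∷ Λ) Δ
  invert-∨₂ {β = β} r M d = exchange (∨L-inv₂ d (↭-++-∷ M r)) (shifts [ β ] M)

  invert-⇒ : ∀ {α β Γ Λ Δ} → Γ ↭ (α ⇒ β) ∷ Λ → ∀ M → Der s (M ++ Γ) Δ → Der s (M ++ β ∷ Λ) Δ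
  invert-⇒ {β = β} r M d = exchange (⇒L-inv d (↭-++-∷ M r)) (shifts [ β ] M)

  Equiv-map : ∀ {φ φ' P} → (∀ {ρ} → Der s [ φ ] (just ρ) → Der s [ φ' ] (just ρ)) →
              (∀ {ρ} → Der s [ ρ ] (just φ) → Der s [ ρ ] (just φ')) → Equiv φ P → Equiv φ' P
  Equiv-map f g []             = []
  Equiv-map f g ((a , b) ∷ as) = (f a , g b) ∷ Equiv-map f g as

  mutual
    cut : ∀ n {A Γ Θ Δ} → size A < n → Der s Γ (just A) → Der s Θ Δ → Θ ↭ A ∷ Γ → Der s Γ Δ
    cut n sz (init p e) d₂ q = exchange (contract d₂ (q ⟫ prep (at p) e)) (↭-sym e)
    cut n sz (⊥L e)     d₂ q = ⊥L e
    cut n {A} sz (∧L {φ = α} {β} e d) d₂ q =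
      ∧L e (cut n sz d (∧L-inv d₂ (q ⟫ prep A e ⟫ swap A _ ↭-refl)) (shifts (α ∷ β ∷ []) [ A ]))
    cut n {A} sz (∨L {φ = α} {β} e d d') d₂ q =
      ∨L e (cut n sz d  (∨L-inv₁ d₂ (q ⟫ prep A e ⟫ swap A _ ↭-refl)) (shifts [ α ] [ A ]))
           (cut n sz d' (∨L-inv₂ d₂ (q ⟫ prep A e ⟫ swap A _ ↭-refl)) (shifts [ β ] [ A ]))
    cut n {A} sz (⇒L {φ = α} {β} e d d') d₂ q =
      ⇒L e d (cut n sz d' (⇒L-inv d₂ (q ⟫ prep A e ⟫ swap A _ ↭-refl)) (shifts [ β ] [ A ]))
    cut n sz (□◇ {Γ = G} P φ ψ x e a d) d₂ q = □◇ {Γ = G} P φ ψ x e a d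
    cut n {A} sz (mp□ {Γ = Γ₀} {φ = φ} {ψ} h e d d') d₂ q =
      mp□ h e d (cut n sz d' (weaken ψ d₂)
        (prep ψ (q ⟫ prep A e) ⟫ solve 4 (λ p a b g → (p ⊕ a ⊕ b ⊕ g) ⊜ (a ⊕ b ⊕ p ⊕ g)) ↭-refl [ ψ ] [ A ] [ φ □→ ψ ] Γ₀))
    cut n sz (∧R d d')   d₂ q = cut-intro n sz (∧R d d') d₂ q
    cut n sz (∨R₁ d)     d₂ q = cut-intro n sz (∨R₁ d) d₂ q
    cut n sz (∨R₂ d)     d₂ q = cut-intro n sz (∨R₂ d) d₂ q
    cut n sz (⇒R d)      d₂ q = cut-intro n sz (⇒R d) d₂ q
    cut n sz (mp◇ h d d') d₂ q = cut-intro n sz (mp◇ h d d') d₂ q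
    cut n sz (□R {Γ = G} P φ ψ x e a d) d₂ q = cut-intro n sz (□R {G = G} P φ ψ x e a d) d₂ q
    cut n sz (◇R {Γ = G} P φ ψ η ϑ x e a d₁ d₁' d) d₂ q =
      cut-intro n sz (◇R {G = G} P φ ψ η ϑ x e a d₁ d₁' d) d₂ q

    cut-intro : ∀ n {A Γ Θ Δ} → size A < n → RightIntro Γ A → Der s Θ Δ → Θ ↭ A ∷ Γ → Der s Γ Δ
    cut-intro (suc n) sz r (init p e) q with ↭-∷-inv q e
    cut-intro (suc n) sz () (init p e) q | inj₁ (refl , _)
    ... | inj₂ (Λ , r₁ , _) = init p r₁
    cut-intro (suc n) sz r (⊥L e) q with ↭-∷-inv q e
    cut-intro (suc n) sz () (⊥L e) q | inj₁ (refl , _)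
    ... | inj₂ (Λ , r₁ , _) = ⊥L r₁
    cut-intro (suc n) (s≤s sz) r (∧L {φ = α} {β} e d) q with ↭-∷-inv q e
    ... | inj₁ (refl , r₁) = cut-∧ n sz r (exchange d (prep α (prep β (↭-sym r₁))))
    ... | inj₂ (Λ , r₁ , r₂) =
      ∧L r₁ (cut-intro (suc n) (s≤s sz) (RI-invert (α ∷ β ∷ []) r r₁ _ (invert-∧ r₁)) d (↭-++-∷ (α ∷ β ∷ []) r₂))
    cut-intro (suc n) (s≤s sz) r (∨L {φ = α} {β} e d d') q with ↭-∷-inv q e
    ... | inj₁ (refl , r₁) = cut-∨ n sz r (exchange d (prep α (↭-sym r₁))) (exchange d' (prep β (↭-sym r₁)))
    ... | inj₂ (Λ , r₁ , r₂) =
      ∨L r₁ (cut-intro (suc n) (s≤s sz) (RI-invert [ α ] r r₁ _ (invert-∨₁ r₁)) d (↭-++-∷ [ α ] r₂))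
            (cut-intro (suc n) (s≤s sz) (RI-invert [ β ] r r₁ _ (invert-∨₂ r₁)) d' (↭-++-∷ [ β ] r₂))
    cut-intro (suc n) {A} (s≤s sz) r (⇒L {φ = α} {β} e d d') q with ↭-∷-inv q e
    ... | inj₁ (refl , r₁) =
      cut-⇒ n sz r (cut-intro (suc n) (s≤s sz) r d (prep A (↭-sym r₁))) (exchange d' (prep β (↭-sym r₁)))
    ... | inj₂ (Λ , r₁ , r₂) =
      ⇒L r₁ (cut-intro (suc n) (s≤s sz) (RI-exchange r r₁) d (↭-++-∷ [ α ⇒ β ] r₂))
            (cut-intro (suc n) (s≤s sz) (RI-invert [ β ] r r₁ _ (invert-⇒ r₁)) d' (↭-++-∷ [ β ] r₂))
    cut-intro (suc n) {A} (s≤s sz) r (mp□ {φ = φ} {ψ} h e d d') q with ↭-∷-inv q e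
    ... | inj₁ (refl , r₁) =
      cut-□-mp□ n sz h r (cut-intro (suc n) (s≤s sz) r d (prep A (↭-sym r₁)))
                         (cut-intro (suc n) (s≤s sz) (RI-weaken ψ r) d' (prep A (prep ψ (↭-sym r₁))))
    ... | inj₂ (Λ , r₁ , r₂) =
      mp□ h r₁ (cut-intro (suc n) (s≤s sz) (RI-exchange r r₁) d (↭-++-∷ [ φ □→ ψ ] r₂))
               (cut-intro (suc n) (s≤s sz) (RI-exchange (RI-weaken ψ r) (prep ψ r₁ ⟫ swap ψ _ ↭-refl)) d'
                          (↭-++-∷ ((φ □→ ψ) ∷ ψ ∷ []) r₂))
    cut-intro (suc n) sz r (∧R d d')   q = ∧R (cut-intro (suc n) sz r d q) (cut-intro (suc n) sz r d' q)
    cut-intro (suc n) sz r (∨R₁ d)     q = ∨R₁ (cut-intro (suc n) sz r d q)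
    cut-intro (suc n) sz r (∨R₂ d)     q = ∨R₂ (cut-intro (suc n) sz r d q)
    cut-intro (suc n) sz r (mp◇ h d d') q = mp◇ h (cut-intro (suc n) sz r d q) (cut-intro (suc n) sz r d' q)
    cut-intro (suc n) sz r (⇒R {φ = φ} d) q = ⇒R (cut-intro (suc n) sz (RI-weaken φ r) d (↭-++-∷ [ φ ] q))
    cut-intro (suc n) (s≤s sz) r (□R {Γ = G} P φ ψ x e a d) q with locate□ G P q e
    ... | in-side G' r₁ = □R {Γ = G'} P φ ψ x r₁ a d
    ... | in-boxes ρ σ P' r₁ r₂ = cut-□-□R n sz r x P r₁ a d r₂
    cut-intro (suc n) (s≤s sz) r (◇R {Γ = G} P φ ψ η ϑ x e a d₁ d₁' d) q with locate◇ G P (φ ◇→ ψ) q e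
    ... | in-side G' r₁ = ◇R {Γ = G'} P φ ψ η ϑ x r₁ a d₁ d₁' d
    ... | in-boxes ρ σ P' r₁ r₂ = cut-□-◇R n {G = G} sz r x P r₁ a d₁ d₁' d r₂
    ... | in-diamond r₂ = cut-◇-◇R n sz r x P a d₁ d₁' d r₂
    cut-intro (suc n) (s≤s sz) r (□◇ {Γ = G} P φ ψ x e a d) q with locate◇ G P (φ ◇→ ψ) q e
    ... | in-side G' r₁ = □◇ {Γ = G'} P φ ψ x r₁ a d
    ... | in-boxes ρ σ P' r₁ r₂ = cut-□-□◇ n {G = G} sz r x P r₁ a d r₂
    ... | in-diamond r₂ = cut-◇-□◇ n sz r x P a d r₂

    cut-∧ : ∀ n {α β Γ Δ} → size (α ∧ β) ≤ n → RightIntro Γ (α ∧ β) → Der s (α ∷ β ∷ Γ) Δ → Der s Γ Δ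
    cut-∧ n {β = β} sz (∧R d₁ d₂) d =
      cut n (1+m+n≤o⇒n<o sz) d₂ (cut n (1+m+n≤o⇒m<o sz) (weaken β d₁) d ↭-refl) ↭-refl

    cut-∨ : ∀ n {α β Γ Δ} → size (α ∨ β) ≤ n → RightIntro Γ (α ∨ β) →
            Der s (α ∷ Γ) Δ → Der s (β ∷ Γ) Δ → Der s Γ Δ
    cut-∨ n sz (∨R₁ d₁) d d' = cut n (1+m+n≤o⇒m<o sz) d₁ d ↭-refl
    cut-∨ n sz (∨R₂ d₂) d d' = cut n (1+m+n≤o⇒n<o sz) d₂ d' ↭-refl

    cut-⇒ : ∀ n {α β Γ Δ} → size (α ⇒ β) ≤ n → RightIntro Γ (α ⇒ β) →
            Der s Γ (just α) → Der s (β ∷ Γ) Δ → Der s Γ Δ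
    cut-⇒ n sz (⇒R d) dα dβ = cut n (1+m+n≤o⇒n<o sz) (cut n (1+m+n≤o⇒m<o sz) dα d ↭-refl) dβ ↭-refl

    Equiv-transfer : ∀ n {φ φ₁ P} → size φ < n → Der s [ φ₁ ] (just φ) → Der s [ φ ] (just φ₁) →
                     Equiv φ P → Equiv φ₁ P
    Equiv-transfer n {φ₁ = φ₁} sz φ₁⊢φ φ⊢φ₁ =
      Equiv-map (λ {ρ} φ⊢ρ → cut n sz φ₁⊢φ (weakenʳ [ φ₁ ] φ⊢ρ) ↭-refl)
                (λ {ρ} ρ⊢φ → cut n sz ρ⊢φ (weakenʳ [ ρ ] φ⊢φ₁) ↭-refl)

    mp-boxes : ∀ n {φ Γ G Δ} → HasMP s → size φ < n → Der s Γ (just φ) → ∀ P → Equiv φ P →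
               Γ ↭ G ++ boxes P → Der s (Γ ++ sigmas P) Δ → Der s Γ Δ
    mp-boxes n {Γ = Γ} h sz dφ [] [] e d = exchange d (↭-reflexive (++-identityʳ Γ))
    mp-boxes n {φ} {Γ} {G} h sz dφ ((ρ , σ) ∷ P) ((φ⊢ρ , _) ∷ as) e d =
      mp□ h e' (exchange (cut n sz dφ (weakenʳ Γ φ⊢ρ) ↭-refl) e')
        (exchange (mp-boxes n h sz (weaken σ dφ) P as (prep σ e') (exchange d (shift σ Γ (sigmas P))))
                  (prep σ e' ⟫ swap σ (ρ □→ σ) ↭-refl))
      where
      e' : Γ ↭ (ρ □→ σ) ∷ G ++ boxes P
      e' = e ⟫ shift (ρ □→ σ) G (boxes P)

    discharge-extra : ∀ n {φ X Γ Δ} → Extra s φ X → size φ < n → Der s Γ (just φ) →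
                      Der s (X ++ Γ) Δ → Der s Γ Δ
    discharge-extra n x sz dφ d with extra-cases x
    ... | inj₁ refl       = d
    ... | inj₂ (_ , refl) = cut n sz dφ d ↭-refl

    transfer-extra : ∀ n {φ₁ φ₂ X₁ X₂ Δ} L T → Extra s φ₁ X₁ → Extra s φ₂ X₂ → size φ₁ < n →
                     Der s [ φ₂ ] (just φ₁) → Der s (L ++ X₁ ++ T) Δ → Der s (L ++ X₂ ++ T) Δ
    transfer-extra n {φ₁} {φ₂} L T x₁ x₂ sz φ₂⊢φ₁ d with extra-uniform x₁ x₂
    ... | inj₁ (refl , refl) = d
    ... | inj₂ (refl , refl) =
      cut n sz (exchange (weakenʳ (L ++ T) φ₂⊢φ₁) (↭-sym (shift φ₂ L T))) (weakenʳ [ φ₂ ] d)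
        (solve 4 (λ a b l t → ((l ⊕ a ⊕ t) ⊕ b) ⊜ (a ⊕ l ⊕ b ⊕ t)) ↭-refl [ φ₁ ] [ φ₂ ] L T)

    -- The premise of a □R introducing φ₁ □→ ψ₁ from the boxes P₁ replaces the box (φ₁ , ψ₁)
    -- among the boxes P of a modal rule: cut ψ₁ in the premise, and transport Equiv along φ₁ ⟺ φ₂.
    merge-□ : ∀ n {φ₁ ψ₁ φ₂ P₁ X₁ X₂ Δ} (T : List Fm) → size (φ₁ □→ ψ₁) ≤ n →
      Extra s φ₁ X₁ → Equiv φ₁ P₁ → Der s (sigmas P₁ ++ X₁) (just ψ₁) →
      Extra s φ₂ X₂ → ∀ P P' → P ↭ (φ₁ , ψ₁) ∷ P' → Equiv φ₂ P → Der s (sigmas P ++ X₂ ++ T) Δ →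
      Equiv φ₂ (P₁ ++ P') × Der s (sigmas (P₁ ++ P') ++ X₂ ++ T) Δ
    merge-□ n {ψ₁ = ψ₁} {φ₂} {P₁} {X₁} {X₂} T sz x₁ a₁ d₁ x₂ P P' r a d with All-resp-↭ r a
    ... | (φ₂⊢φ₁ , φ₁⊢φ₂) ∷ a' =
      ++⁺ (Equiv-transfer n (1+m+n≤o⇒m<o sz) φ₂⊢φ₁ φ₁⊢φ₂ a₁) a' ,
      exchange merged (↭-reflexive (sym (++-assoc S₁ S' (X₂ ++ T))) ⟫ ++⁺ʳ (X₂ ++ T) (↭-sym (sigmas-++ P₁ P')))
      where
      S₁ = sigmas P₁
      S' = sigmas P'
      S₁X₂⊢ψ₁ : Der s (S₁ ++ X₂) (just ψ₁)
      S₁X₂⊢ψ₁ = exchange (transfer-extra n S₁ [] x₁ x₂ (1+m+n≤o⇒m<o sz) φ₂⊢φ₁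
                            (exchange d₁ (++⁺ˡ S₁ (↭-++-[] X₁))))
                         (++⁺ˡ S₁ (↭-sym (↭-++-[] X₂)))
      merged : Der s (S₁ ++ S' ++ X₂ ++ T) _
      merged = cut n (1+m+n≤o⇒n<o sz)
        (exchange (weakenʳ (S' ++ T) S₁X₂⊢ψ₁)
                  (solve 4 (λ a b c e → ((a ⊕ b) ⊕ c ⊕ e) ⊜ (a ⊕ c ⊕ b ⊕ e)) ↭-refl S₁ X₂ S' T))
        (weakenʳ S₁ d)
        (++⁺ʳ S₁ (++⁺ʳ (X₂ ++ T) (map⁺ proj₂ r)) ⟫
         solve 5 (λ p k x t a → ((p ⊕ k ⊕ x ⊕ t) ⊕ a) ⊜ (p ⊕ a ⊕ k ⊕ x ⊕ t)) ↭-refl [ ψ₁ ] S' X₂ T S₁)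

    cut-□-□R : ∀ n {ρ σ Γ G φ ψ X P'} → size (ρ □→ σ) ≤ n → RightIntro Γ (ρ □→ σ) → Extra s φ X → ∀ P →
               P ↭ (ρ , σ) ∷ P' → Equiv φ P → Der s (sigmas P ++ X) (just ψ) → Γ ↭ G ++ boxes P' →
               Der s Γ (just (φ □→ ψ))
    cut-□-□R n {G = G} {φ} {ψ} {X} {P'} sz (□R {G₁} P₁ _ _ x₁ e₁ a₁ d₁) x P r a d r₂
      with merge-□ n [] sz x₁ a₁ d₁ x P P' r a (exchange d (++⁺ˡ (sigmas P) (↭-++-[] X)))
    ... | a' , d' =
      contract-++ (boxes P₁) {G₁}
        (□R {Γ = G} (P₁ ++ P') φ ψ x (boxes-prepend-□ G P' P₁ r₂) a' (exchange d' (++⁺ˡ _ (↭-sym (↭-++-[] X)))))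
        e₁

    cut-□-◇R : ∀ n {ρ σ Γ G φ ψ η ϑ X P'} → size (ρ □→ σ) ≤ n → RightIntro Γ (ρ □→ σ) → Extra s φ X → ∀ P →
               P ↭ (ρ , σ) ∷ P' → Equiv φ P → Der s [ φ ] (just η) → Der s [ η ] (just φ) →
               Der s (sigmas P ++ X ++ [ ψ ]) (just ϑ) → Γ ↭ G ++ boxes P' ++ [ φ ◇→ ψ ] →
               Der s Γ (just (η ◇→ ϑ))
    cut-□-◇R n {G = G} {φ} {ψ} {η} {ϑ} {P' = P'} sz (□R {G₁} P₁ _ _ x₁ e₁ a₁ d₁) x P r a f f' d r₂
      with merge-□ n [ ψ ] sz x₁ a₁ d₁ x P P' r a d
    ... | a' , d' =
      contract-++ (boxes P₁) {G₁} (◇R {Γ = G} (P₁ ++ P') φ ψ η ϑ x (boxes-prepend-◇ G P' P₁ r₂) a' f f' d') e₁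

    cut-□-□◇ : ∀ n {ρ σ Γ G φ ψ X P' Δ} → size (ρ □→ σ) ≤ n → RightIntro Γ (ρ □→ σ) → Extra s φ X → ∀ P →
               P ↭ (ρ , σ) ∷ P' → Equiv φ P → Der s (sigmas P ++ X ++ [ ψ ]) nothing →
               Γ ↭ G ++ boxes P' ++ [ φ ◇→ ψ ] → Der s Γ Δ
    cut-□-□◇ n {G = G} {φ} {ψ} {P' = P'} sz (□R {G₁} P₁ _ _ x₁ e₁ a₁ d₁) x P r a d r₂
      with merge-□ n [ ψ ] sz x₁ a₁ d₁ x P P' r a d
    ... | a' , d' =
      contract-++ (boxes P₁) {G₁} (□◇ {Γ = G} (P₁ ++ P') φ ψ x (boxes-prepend-◇ G P' P₁ r₂) a' d') e₁

    cut-□-mp□ : ∀ n {ρ σ Γ Δ} → size (ρ □→ σ) ≤ n → HasMP s → RightIntro Γ (ρ □→ σ) →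
                Der s Γ (just ρ) → Der s (σ ∷ Γ) Δ → Der s Γ Δ
    cut-□-mp□ n {Γ = Γ} sz h (□R {X = X₁} P₁ _ _ x₁ e₁ a₁ d₁) dρ dσ =
      cut n (1+m+n≤o⇒n<o sz)
        (mp-boxes n h (1+m+n≤o⇒m<o sz) dρ P₁ a₁ e₁
          (discharge-extra n x₁ (1+m+n≤o⇒m<o sz) (weakenʳ (sigmas P₁) dρ)
            (exchange (weakenʳ Γ d₁) (solve 3 (λ a x g → ((a ⊕ x) ⊕ g) ⊜ (x ⊕ g ⊕ a)) ↭-refl (sigmas P₁) X₁ Γ))))
        dσ ↭-refl

    merge-◇ : ∀ n {φ ψ φ₁ ψ₁ X X₁ P₁ Δ} P → size φ < n → size ψ < n → Extra s φ₁ X₁ → Extra s φ X →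
              Der s [ φ₁ ] (just φ) → Der s (sigmas P₁ ++ X₁ ++ [ ψ₁ ]) (just ψ) →
              Der s (sigmas P ++ X ++ [ ψ ]) Δ → Der s (sigmas (P₁ ++ P) ++ X₁ ++ [ ψ₁ ]) Δ
    merge-◇ n {ψ = ψ} {ψ₁ = ψ₁} {X₁ = X₁} {P₁} P szφ szψ x₁ x φ₁⊢φ d₁ d =
      exchange merged
        (↭-reflexive (sym (++-assoc S₁ S (X₁ ++ [ ψ₁ ]))) ⟫ ++⁺ʳ (X₁ ++ [ ψ₁ ]) (↭-sym (sigmas-++ P₁ P)))
      where
      S₁ = sigmas P₁
      S  = sigmas P
      merged : Der s (S₁ ++ S ++ X₁ ++ [ ψ₁ ]) _
      merged = cut n szψ
        (exchange (weakenʳ S d₁) (solve 4 (λ a x e p → ((a ⊕ x ⊕ e) ⊕ p) ⊜ (a ⊕ p ⊕ x ⊕ e)) ↭-refl S₁ X₁ [ ψ₁ ] S))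
        (weakenʳ (S₁ ++ [ ψ₁ ]) (transfer-extra n S [ ψ ] x x₁ szφ φ₁⊢φ d))
        (solve 5 (λ p x c a e → ((p ⊕ x ⊕ c) ⊕ (a ⊕ e)) ⊜ (c ⊕ a ⊕ p ⊕ x ⊕ e)) ↭-refl S X₁ [ ψ ] S₁ [ ψ₁ ])

    mp-◇-premise : ∀ n {φ ψ Γ G X Δ} → HasMP s → size φ < n → size ψ < n →
                   Der s Γ (just φ) → Der s Γ (just ψ) → Extra s φ X → ∀ P → Equiv φ P →
                   Γ ↭ G ++ boxes P → Der s (sigmas P ++ X ++ [ ψ ]) Δ → Der s Γ Δ
    mp-◇-premise n {ψ = ψ} {Γ} {X = X} h szφ szψ dφ dψ x P a r d =
      mp-boxes n h szφ dφ P a r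
        (cut n szψ (weakenʳ (sigmas P) dψ)
          (discharge-extra n x szφ (weaken ψ (weakenʳ (sigmas P) dφ))
            (exchange (weakenʳ Γ d)
              (solve 4 (λ p x c g → ((p ⊕ x ⊕ c) ⊕ g) ⊜ (x ⊕ c ⊕ g ⊕ p)) ↭-refl (sigmas P) X [ ψ ] Γ)))
          ↭-refl)

    cut-◇-◇R : ∀ n {φ ψ η ϑ Γ G X} → size (φ ◇→ ψ) ≤ n → RightIntro Γ (φ ◇→ ψ) → Extra s φ X → ∀ P →
               Equiv φ P → Der s [ φ ] (just η) → Der s [ η ] (just φ) →
               Der s (sigmas P ++ X ++ [ ψ ]) (just ϑ) → Γ ↭ G ++ boxes P → Der s Γ (just (η ◇→ ϑ))
    cut-◇-◇R n {η = η} {ϑ} {G = G} sz (◇R {G₁} P₁ φ₁ ψ₁ _ _ x₁ e₁ a₁ g g' d₁) x P a f f' d r =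
      contract-++ (boxes P) {G}
        (◇R {Γ = G₁} (P₁ ++ P) φ₁ ψ₁ η ϑ x₁ (boxes-append-◇ G₁ P₁ P e₁)
          (++⁺ a₁ (Equiv-transfer n (1+m+n≤o⇒m<o sz) g g' a))
          (cut n (1+m+n≤o⇒m<o sz) g (weakenʳ [ φ₁ ] f) ↭-refl)
          (cut n (1+m+n≤o⇒m<o sz) f' (weakenʳ [ η ] g') ↭-refl)
          (merge-◇ n {P₁ = P₁} P (1+m+n≤o⇒m<o sz) (1+m+n≤o⇒n<o sz) x₁ x g d₁ d))
        r
    cut-◇-◇R n {Γ = Γ} sz (mp◇ h dφ dψ) x P a f f' d r =
      mp◇ h (cut n (1+m+n≤o⇒m<o sz) dφ (weakenʳ Γ f) ↭-refl)
            (mp-◇-premise n h (1+m+n≤o⇒m<o sz) (1+m+n≤o⇒n<o sz) dφ dψ x P a r d)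

    cut-◇-□◇ : ∀ n {φ ψ Γ G X Δ} → size (φ ◇→ ψ) ≤ n → RightIntro Γ (φ ◇→ ψ) → Extra s φ X → ∀ P →
               Equiv φ P → Der s (sigmas P ++ X ++ [ ψ ]) nothing → Γ ↭ G ++ boxes P → Der s Γ Δ
    cut-◇-□◇ n {G = G} sz (◇R {G₁} P₁ φ₁ ψ₁ _ _ x₁ e₁ a₁ g g' d₁) x P a d r =
      contract-++ (boxes P) {G}
        (□◇ {Γ = G₁} (P₁ ++ P) φ₁ ψ₁ x₁ (boxes-append-◇ G₁ P₁ P e₁)
          (++⁺ a₁ (Equiv-transfer n (1+m+n≤o⇒m<o sz) g g' a))
          (merge-◇ n {P₁ = P₁} P (1+m+n≤o⇒m<o sz) (1+m+n≤o⇒n<o sz) x₁ x g d₁ d))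
        r
    cut-◇-□◇ n sz (mp◇ h dφ dψ) x P a d r =
      weaken-succedent (mp-◇-premise n h (1+m+n≤o⇒m<o sz) (1+m+n≤o⇒n<o sz) dφ dψ x P a r d)

  cut-admissible : ∀ {A Γ Δ} → Der s Γ (just A) → Der s (A ∷ Γ) Δ → Der s Γ Δ
  cut-admissible {A} d₁ d₂ = cut (suc (size A)) ≤-refl d₁ d₂ ↭-refl

module Completeness (s : Star) where
  open Structural s
  open Cut s using (cut-admissible)

  assumption : ∀ {φ Γ} → φ ∈ Γ → Der s Γ (just φ)
  assumption {φ} φ∈Γ with ∈⇒↭ φ∈Γ
  ... | _ , r = exchange (identity φ) (↭-sym r)

  ⇒-elim : ∀ {α β Γ} → Der s Γ (just (α ⇒ β)) → Der s Γ (just α) → Der s Γ (just β)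
  ⇒-elim {α} {β} d dα = cut-admissible d (⇒L ↭-refl (weaken (α ⇒ β) dα) (identity β))

  ∧-elim₁ : ∀ {α β Γ} → Der s Γ (just (α ∧ β)) → Der s Γ (just α)
  ∧-elim₁ {α} d = cut-admissible d (∧L ↭-refl (identity α))

  ∧-elim₂ : ∀ {α β Γ} → Der s Γ (just (α ∧ β)) → Der s Γ (just β)
  ∧-elim₂ {α} {β} d = cut-admissible d (∧L ↭-refl (weaken α (identity β)))

  ⇔-elim : ∀ {α β} → Der s [] (just (α ⇔ β)) → Der s [ α ] (just β) × Der s [ β ] (just α)
  ⇔-elim {α} {β} d = ⇒-elim (weaken α (∧-elim₁ d)) (identity α) , ⇒-elim (weaken β (∧-elim₂ d)) (identity β)

  □R₁ : ∀ {ρ σ φ ψ X} → Extra s φ X → Der s [ φ ] (just ρ) → Der s [ ρ ] (just φ) →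
        Der s (σ ∷ X) (just ψ) → Der s [ ρ □→ σ ] (just (φ □→ ψ))
  □R₁ {ρ} {σ} {φ} {ψ} x f g d = □R {Γ = []} [ (ρ , σ) ] φ ψ x ↭-refl ((f , g) ∷ []) d

  ◇R₀ : ∀ {φ ψ η ϑ X} → Extra s φ X → Der s [ φ ] (just η) → Der s [ η ] (just φ) →
        Der s (X ++ [ ψ ]) (just ϑ) → Der s [ φ ◇→ ψ ] (just (η ◇→ ϑ))
  ◇R₀ {φ} {ψ} {η} {ϑ} x f g d = ◇R {Γ = []} [] φ ψ η ϑ x ↭-refl [] f g d

  derive : ∀ {φ} → Thm s φ → Der s [] (just φ)
  derive (ax-K φ ψ)     = ⇒R (⇒R (assumption (there (here refl))))
  derive (ax-S φ ψ χ)   =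
    ⇒R (⇒R (⇒R (⇒-elim (⇒-elim (assumption (there (there (here refl)))) (assumption (here refl)))
                       (⇒-elim (assumption (there (here refl))) (assumption (here refl))))))
  derive (ax-∧E₁ φ ψ)   = ⇒R (∧-elim₁ (assumption (here refl)))
  derive (ax-∧E₂ φ ψ)   = ⇒R (∧-elim₂ (assumption (here refl)))
  derive (ax-∧I φ ψ)    = ⇒R (⇒R (∧R (assumption (there (here refl))) (assumption (here refl))))
  derive (ax-∨I₁ φ ψ)   = ⇒R (∨R₁ (assumption (here refl)))
  derive (ax-∨I₂ φ ψ)   = ⇒R (∨R₂ (assumption (here refl)))
  derive (ax-∨E φ ψ χ)  =
    ⇒R (⇒R (⇒R (∨L ↭-refl (⇒-elim (assumption (there (there (here refl)))) (assumption (here refl)))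
                          (⇒-elim (assumption (there (here refl))) (assumption (here refl))))))
  derive (ax-⊥E φ)      = ⇒R (⊥L ↭-refl)
  derive (mp t t')      = ⇒-elim (derive t) (derive t')
  derive (CM□ φ ψ χ)    =
    ⇒R (∧R (□R₁ (proj₂ (extra s φ)) (identity φ) (identity φ) (∧L ↭-refl (identity ψ)))
           (□R₁ (proj₂ (extra s φ)) (identity φ) (identity φ) (∧L ↭-refl (weaken ψ (identity χ)))))
  derive (CC□ φ ψ χ)    =
    ⇒R (∧L ↭-refl (□R {Γ = []} ((φ , ψ) ∷ (φ , χ) ∷ []) φ (ψ ∧ χ) (proj₂ (extra s φ)) ↭-refl
                      ((identity φ , identity φ) ∷ (identity φ , identity φ) ∷ [])
                      (∧R (identity ψ) (weaken ψ (identity χ)))))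
  derive (CN□ φ)        = □R {Γ = []} [] φ ⊤' (proj₂ (extra s φ)) ↭-refl [] (⇒R (⊥L ↭-refl))
  derive (CN◇ φ) with extra s φ
  ... | X , x = ⇒R (□◇ {Γ = []} [] φ ⊥' x ↭-refl [] (⊥L (++-comm X [ ⊥' ])))
  derive (CK◇ φ ψ χ) with extra s φ
  ... | X , x =
    ⇒R (⇒R (◇R {Γ = []} [ (φ , ψ ⇒ χ) ] φ ψ φ χ x (swap _ _ ↭-refl) ((identity φ , identity φ) ∷ [])
                (identity φ) (identity φ)
                (⇒-elim (assumption (here refl)) (assumption (there (∈-++⁺ʳ X (here refl)))))))
  derive (RA□ {φ} {ρ} ψ t) with ⇔-elim (derive t)
  ... | φ⊢ρ , ρ⊢φ = ∧R (⇒R (□R₁ (proj₂ (extra s ρ)) ρ⊢φ φ⊢ρ (identity ψ)))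
                       (⇒R (□R₁ (proj₂ (extra s φ)) φ⊢ρ ρ⊢φ (identity ψ)))
  derive (RC□ φ {ψ} {χ} t) with ⇔-elim (derive t) | extra s φ
  ... | ψ⊢χ , χ⊢ψ | X , x = ∧R (⇒R (□R₁ x (identity φ) (identity φ) (weakenʳ X ψ⊢χ)))
                               (⇒R (□R₁ x (identity φ) (identity φ) (weakenʳ X χ⊢ψ)))
  derive (RA◇ {φ} {ρ} ψ t) with ⇔-elim (derive t) | extra s φ | extra s ρ
  ... | φ⊢ρ , ρ⊢φ | X , x | Y , y =
    ∧R (⇒R (◇R₀ x φ⊢ρ ρ⊢φ (exchange (identity ψ) (++-comm [ ψ ] X))))
       (⇒R (◇R₀ y ρ⊢φ φ⊢ρ (exchange (identity ψ) (++-comm [ ψ ] Y))))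
  derive (RC◇ φ {ψ} {χ} t) with ⇔-elim (derive t) | extra s φ
  ... | ψ⊢χ , χ⊢ψ | X , x = ∧R (⇒R (◇R₀ x (identity φ) (identity φ) (weakenˡ X ψ⊢χ)))
                               (⇒R (◇R₀ x (identity φ) (identity φ) (weakenˡ X χ⊢ψ)))
  derive (ID□ h φ) with extra s φ
  ... | X , x with extra-id h x
  ...   | refl = □R {Γ = []} [] φ φ x ↭-refl [] (identity φ)
  derive (MP□ h φ ψ) =
    ⇒R (⇒R (mp□ h (swap _ _ ↭-refl) (assumption (there (here refl))) (assumption (there (here refl)))))
  derive (MP◇ h φ ψ) = ⇒R (∧L ↭-refl (mp◇ h (identity φ) (weaken φ (identity ψ))))

  ⋀-intro : ∀ {Γ} L → (∀ {x} → x ∈ L → Der s Γ (just x)) → Der s Γ (just (⋀ L))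
  ⋀-intro []          f = ⇒R (⊥L ↭-refl)
  ⋀-intro (φ ∷ [])    f = f (here refl)
  ⋀-intro (φ ∷ ψ ∷ L) f = ∧R (f (here refl)) (⋀-intro (ψ ∷ L) (λ m → f (there m)))

  ⋁-elim : ∀ {Γ} Δ → Der s Γ (just (⋁ Δ)) → Der s Γ Δ
  ⋁-elim (just φ) d = d
  ⋁-elim nothing  d = cut-admissible d (⊥L ↭-refl)

  completeness : ∀ Γ Δ → Thm s (ι Γ Δ) → Der s Γ Δ
  completeness []      Δ t = ⋁-elim Δ (derive t)
  completeness (φ ∷ Γ) Δ t = ⋁-elim Δ (⇒-elim (weakenʳ (φ ∷ Γ) (derive t)) (⋀-intro (φ ∷ Γ) assumption))

module Soundness (s : Star) where

  infix 3 _⊢_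

  data _⊢_ (Γ : List Fm) : Fm → Set where
    hyp : ∀ {φ} → φ ∈ Γ → Γ ⊢ φ
    thm : ∀ {φ} → Thm s φ → Γ ⊢ φ
    app : ∀ {φ ψ} → Γ ⊢ φ ⇒ ψ → Γ ⊢ φ → Γ ⊢ ψ

  ⇒-refl : ∀ φ → Thm s (φ ⇒ φ)
  ⇒-refl φ = mp (mp (ax-S φ (φ ⇒ φ) φ) (ax-K φ (φ ⇒ φ))) (ax-K φ φ)

  deduction : ∀ {φ Γ ψ} → φ ∷ Γ ⊢ ψ → Γ ⊢ φ ⇒ ψ
  deduction {φ}          (hyp (here refl)) = thm (⇒-refl φ)
  deduction {φ} {ψ = ψ}  (hyp (there m))   = app (thm (ax-K ψ φ)) (hyp m)
  deduction {φ} {ψ = ψ}  (thm t)           = app (thm (ax-K ψ φ)) (thm t)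
  deduction {φ} {ψ = ψ}  (app {α} f a)     = app (app (thm (ax-S φ α ψ)) (deduction f)) (deduction a)

  closed : ∀ {φ} → [] ⊢ φ → Thm s φ
  closed (thm t)   = t
  closed (app f a) = mp (closed f) (closed a)

  substitute : ∀ {Γ Γ' φ} → (∀ {x} → x ∈ Γ → Γ' ⊢ x) → Γ ⊢ φ → Γ' ⊢ φ
  substitute σ (hyp m)   = σ m
  substitute σ (thm t)   = thm t
  substitute σ (app f a) = app (substitute σ f) (substitute σ a)

  rename : ∀ {Γ Γ' φ} → (∀ {x} → x ∈ Γ → x ∈ Γ') → Γ ⊢ φ → Γ' ⊢ φ
  rename ρ = substitute (λ m → hyp (ρ m))

  let-in : ∀ {Γ α β} → Γ ⊢ α → α ∷ Γ ⊢ β → Γ ⊢ β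
  let-in a d = app (deduction d) a

  ∧-intro : ∀ {Γ α β} → Γ ⊢ α → Γ ⊢ β → Γ ⊢ α ∧ β
  ∧-intro {α = α} {β} a b = app (app (thm (ax-∧I α β)) a) b

  ∧-elim₁ : ∀ {Γ α β} → Γ ⊢ α ∧ β → Γ ⊢ α
  ∧-elim₁ {α = α} {β} d = app (thm (ax-∧E₁ α β)) d

  ∧-elim₂ : ∀ {Γ α β} → Γ ⊢ α ∧ β → Γ ⊢ β
  ∧-elim₂ {α = α} {β} d = app (thm (ax-∧E₂ α β)) d

  ⊥-elim⊢ : ∀ {Γ φ} → Γ ⊢ ⊥' → Γ ⊢ φ
  ⊥-elim⊢ {φ = φ} d = app (thm (ax-⊥E φ)) d

  ⇔-thm : ∀ {φ ρ} → [ φ ] ⊢ ρ → [ ρ ] ⊢ φ → Thm s (φ ⇔ ρ)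
  ⇔-thm f g = closed (∧-intro (deduction f) (deduction g))

  ⋀-proj : ∀ {Γ x} L → x ∈ L → Γ ⊢ ⋀ L → Γ ⊢ x
  ⋀-proj (x ∷ [])    (here refl) d = d
  ⋀-proj (x ∷ y ∷ L) (here refl) d = ∧-elim₁ d
  ⋀-proj (x ∷ y ∷ L) (there m)   d = ⋀-proj (y ∷ L) m (∧-elim₂ d)

  □-mono : ∀ {Γ φ α β} → Thm s (α ⇒ β) → Γ ⊢ φ □→ α → Γ ⊢ φ □→ β
  □-mono {φ = φ} {α} {β} t d = ∧-elim₂ (app (thm (CM□ φ α β)) (app (∧-elim₁ (thm (RC□ φ α⇔α∧β))) d))
    where
    α⇔α∧β : Thm s (α ⇔ (α ∧ β))
    α⇔α∧β = closed (∧-intro (deduction (∧-intro (hyp (here refl)) (app (thm t) (hyp (here refl)))))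
                            (deduction (∧-elim₁ (hyp (here refl)))))

  □-⋀ : ∀ {Γ φ} L → (∀ {x} → x ∈ L → Γ ⊢ φ □→ x) → Γ ⊢ φ □→ ⋀ L
  □-⋀ {φ = φ} []          f = thm (CN□ φ)
  □-⋀         (x ∷ [])    f = f (here refl)
  □-⋀ {φ = φ} (x ∷ y ∷ L) f =
    app (thm (CC□ φ x (⋀ (y ∷ L)))) (∧-intro (f (here refl)) (□-⋀ (y ∷ L) (λ m → f (there m))))

  □-K : ∀ {Γ φ θ} L → (∀ {x} → x ∈ L → Γ ⊢ φ □→ x) → L ⊢ θ → Γ ⊢ φ □→ θ
  □-K L f d = □-mono (closed (deduction (substitute (λ m → ⋀-proj L m (hyp (here refl))) d))) (□-⋀ L f)

  ι-thm : ∀ Γ Δ → Γ ⊢ ⋁ Δ → Thm s (ι Γ Δ)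
  ι-thm []      Δ d = closed d
  ι-thm (φ ∷ Γ) Δ d = closed (deduction (substitute (λ m → ⋀-proj (φ ∷ Γ) m (hyp (here refl))) d))

  HEquiv : Fm → List (Fm × Fm) → Set
  HEquiv φ P = All (λ p → [ φ ] ⊢ proj₁ p × [ proj₁ p ] ⊢ φ) P

  □-premises : ∀ {Γ φ X} P → (∀ {p} → p ∈ P → box p ∈ Γ) → HEquiv φ P → Extra s φ X →
               ∀ {x} → x ∈ sigmas P ++ X → Γ ⊢ φ □→ x
  □-premises P boxes∈Γ eqs x m with ∈-++⁻ (sigmas P) m
  ... | inj₁ σ∈P with ∈-map⁻ proj₂ σ∈P
  ...   | (ρ , σ) , p∈P , refl with lookup eqs p∈P
  ...     | φ⊢ρ , ρ⊢φ = app (∧-elim₁ (thm (RA□ σ (⇔-thm ρ⊢φ φ⊢ρ)))) (hyp (boxes∈Γ p∈P))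
  □-premises {φ = φ} P boxes∈Γ eqs x m | inj₂ φ∈X with extra-cases x
  ... | inj₁ refl with φ∈X
  ...   | ()
  □-premises {φ = φ} P boxes∈Γ eqs x m | inj₂ (here refl) | inj₂ (h , refl) = thm (ID□ h φ)

  ↭-∈ : ∀ {Γ Γ'} {x : Fm} → Γ' ↭ Γ → x ∈ Γ → x ∈ Γ'
  ↭-∈ e = ∈-resp-↭ (↭-sym e)

  ⊆-premise : ∀ {Γ Γ' y z} → Γ' ↭ y ∷ Γ → ∀ {x} → x ∈ z ∷ Γ → x ∈ z ∷ Γ'
  ⊆-premise e (here refl) = here refl
  ⊆-premise e (there m)   = there (↭-∈ e (there m))

  -- CK◇ applied to the diamond of the rule, the boxes supplying φ □→ (ψ ⇒ ϑ) through □-K.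
  ◇-consequence : ∀ {Γ G X} P φ ψ {ϑ} → Extra s φ X → Γ ↭ G ++ boxes P ++ [ φ ◇→ ψ ] → HEquiv φ P →
                  sigmas P ++ X ++ [ ψ ] ⊢ ϑ → Γ ⊢ φ ◇→ ϑ
  ◇-consequence {G = G} {X} P φ ψ {ϑ} x e eqs d =
    app (app (thm (CK◇ φ ψ ϑ)) (□-K (sigmas P ++ X) (□-premises P boxes∈Γ eqs x) (deduction (rename ψ-first d))))
        (hyp (↭-∈ e (∈-++⁺ʳ G (∈-++⁺ʳ (boxes P) (here refl)))))
    where
    boxes∈Γ : ∀ {p} → p ∈ P → box p ∈ _
    boxes∈Γ p∈P = ↭-∈ e (∈-++⁺ʳ G (∈-++⁺ˡ (∈-map⁺ box p∈P)))
    ψ-first : ∀ {x} → x ∈ sigmas P ++ X ++ [ ψ ] → x ∈ ψ ∷ sigmas P ++ X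
    ψ-first = ∈-resp-↭ (solve 3 (λ a b c → (a ⊕ b ⊕ c) ⊜ (c ⊕ a ⊕ b)) ↭-refl (sigmas P) X [ ψ ])

  mutual
    soundness : ∀ {Γ Δ} → Der s Γ Δ → Γ ⊢ ⋁ Δ
    soundness (init p e) = hyp (↭-∈ e (here refl))
    soundness (⊥L e)     = ⊥-elim⊢ (hyp (↭-∈ e (here refl)))
    soundness (∧L e d)   = substitute unpack (soundness d)
      where
      unpack : ∀ {x} → x ∈ _ → _ ⊢ x
      unpack (here refl)         = ∧-elim₁ (hyp (↭-∈ e (here refl)))
      unpack (there (here refl)) = ∧-elim₂ (hyp (↭-∈ e (here refl)))
      unpack (there (there m))   = hyp (↭-∈ e (there m))
    soundness (∧R d d')  = ∧-intro (soundness d) (soundness d')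
    soundness (∨L {Δ = Δ} {φ = α} {β} e d d') =
      app (app (app (thm (ax-∨E α β (⋁ Δ))) (deduction (rename (⊆-premise e) (soundness d))))
                                            (deduction (rename (⊆-premise e) (soundness d'))))
          (hyp (↭-∈ e (here refl)))
    soundness (∨R₁ {φ = φ} {ψ} d) = app (thm (ax-∨I₁ φ ψ)) (soundness d)
    soundness (∨R₂ {φ = φ} {ψ} d) = app (thm (ax-∨I₂ φ ψ)) (soundness d)
    soundness (⇒R d)     = deduction (soundness d)
    soundness (⇒L e d d') =
      let-in (app (hyp (↭-∈ e (here refl))) (rename (↭-∈ e) (soundness d))) (rename (⊆-premise e) (soundness d'))
    soundness (mp□ {φ = φ} {ψ} h e d d') = substitute unpack (soundness d')
      where
      unpack : ∀ {x} → x ∈ _ → _ ⊢ x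
      unpack (here refl)         = hyp (↭-∈ e (here refl))
      unpack (there (here refl)) = app (app (thm (MP□ h φ ψ)) (hyp (↭-∈ e (here refl)))) (rename (↭-∈ e) (soundness d))
      unpack (there (there m))   = hyp (↭-∈ e (there m))
    soundness (mp◇ {φ = φ} {ψ} h d d') = app (thm (MP◇ h φ ψ)) (∧-intro (soundness d) (soundness d'))
    soundness (□R {Γ = G} {X = X} P φ ψ x e a d) =
      □-K (sigmas P ++ X) (□-premises P (λ p∈P → ↭-∈ e (∈-++⁺ʳ G (∈-map⁺ box p∈P))) (soundness-Equiv a) x)
          (soundness d)
    soundness (◇R {Γ = G} P φ ψ η ϑ x e a d₁ d₂ d) =
      app (∧-elim₁ (thm (RA◇ ϑ (⇔-thm (soundness d₁) (soundness d₂)))))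
          (◇-consequence {G = G} P φ ψ x e (soundness-Equiv a) (soundness d))
    soundness (□◇ {Γ = G} P φ ψ x e a d) =
      ⊥-elim⊢ (app (thm (CN◇ φ)) (◇-consequence {G = G} P φ ψ x e (soundness-Equiv a) (soundness d)))

    soundness-Equiv : ∀ {φ P} → Structural.Equiv s φ P → HEquiv φ P
    soundness-Equiv []              = []
    soundness-Equiv ((f , g) ∷ as) = (soundness f , soundness g) ∷ soundness-Equiv as

theorem11 : (s : Star) (Γ : List Fm) (Δ : Maybe Fm) →
    (Der s Γ Δ → Thm s (ι Γ Δ)) × (Thm s (ι Γ Δ) → Der s Γ Δ)
theorem11 s Γ Δ = (λ d → Soundness.ι-thm s Γ Δ (Soundness.soundness s d)) , Completeness.completeness s Γ Δ
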